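{- Let $n,m\ge2$ and let $q=(q_0,\ldots,q_{n-1})$ and $q'=(q'_0,\ldots,q'_{m-1})$ be quiddities of orders $n$ and $m$. Then there exist infinitely many arrays $(a_{i,j})_{(i,j)\in\mathbb{Z}^2}$ such that $a_{i,j}a_{i+1,j+1}-a_{i,j+1}a_{i+1,j}=1$ for all $i,j$, $a_{i,j+n}=-a_{i,j}$ and $a_{i+m,j}=-a_{i,j}$ for all $i,j$, $a_{i,j}\in\mathbb{Z}_{>0}$ for $0\le i\le m-1$, $0\le j\le n-1$, and $a_{i,j+1}=q_ja_{i,j}-a_{i,j-1}$, $a_{i+1,j}=q'_ia_{i,j}-a_{i-1,j}$ for all $i,j$ (with $q,q'$ extended periodically).
   Context: A quiddity of order $n\ge3$ is a sequence $(q_0,\ldots,q_{n-1})$ of positive integers such that some triangulation of a convex $n$-gon with vertices labelled $0,\ldots,n-1$ cyclically has exactly $q_i$ triangles incident to vertex $i$ for each $i$; the (degenerate) quiddity of order $2$ is $(0,0)$. -}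

module Defs where

open import Data.Nat as ℕ using (ℕ; zero; suc; _≤_)
open import Data.Nat.Base using (_<ᵇ_; _≡ᵇ_)
open import Data.Bool using (Bool; true; false; _∧_; _∨_; not; if_then_else_)
open import Data.Fin using (Fin; toℕ; fromℕ<)
open import Data.List using (List; map; allFin)
open import Data.Nat.ListAction using (sum)
open import Data.Integer as ℤ using (ℤ; +_)
open import Data.Integer.DivMod using (_%ℕ_; n%ℕd<d)
open import Data.Product using (Σ; ∃; ∃₂; _×_)
open import Data.Sum using (_⊎_)
open import Relation.Binary.PropositionalEquality using (_≡_)
open import Relation.Nullary using (¬_)

-- Vertices of the convex n-gon are 0,…,n-1 (Fin n), labelled cyclically.
-- For vertices a, b with a < b:
-- polygon side: b = a+1, or {a,b} = {0,n-1}
isSide : (n : ℕ) → Fin n → Fin n → Bool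
isSide n a b = (toℕ a <ᵇ toℕ b) ∧ ((suc (toℕ a) ≡ᵇ toℕ b) ∨ ((toℕ a ≡ᵇ 0) ∧ (suc (toℕ b) ≡ᵇ n)))

isDiagonal : (n : ℕ) → Fin n → Fin n → Bool
isDiagonal n a b = (toℕ a <ᵇ toℕ b) ∧ not (isSide n a b)

crosses : {n : ℕ} → Fin n → Fin n → Fin n → Fin n → Bool
crosses a b c d =
  ((toℕ a <ᵇ toℕ c) ∧ (toℕ c <ᵇ toℕ b) ∧ (toℕ b <ᵇ toℕ d))
  ∨ ((toℕ c <ᵇ toℕ a) ∧ (toℕ a <ᵇ toℕ d) ∧ (toℕ d <ᵇ toℕ b))

-- A triangulation of the convex n-gon: a maximal set of pairwise
-- non-crossing diagonals.  The set is given by its characteristic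
-- function D on ordered pairs (a,b) with a < b.
record Triangulation (n : ℕ) : Set where
  field
    D        : Fin n → Fin n → Bool
    D-diag   : ∀ a b → D a b ≡ true → isDiagonal n a b ≡ true
    noncross : ∀ a b c d → D a b ≡ true → D c d ≡ true → crosses a b c d ≡ false
    maximal  : ∀ a b → isDiagonal n a b ≡ true →
               D a b ≡ true ⊎ ∃₂ λ c d → D c d ≡ true × crosses a b c d ≡ true

open Triangulation public

isEdge : {n : ℕ} → Triangulation n → Fin n → Fin n → Bool
isEdge {n} T a b = isSide n a b ∨ D T a b

isTriangle : {n : ℕ} → Triangulation n → Fin n → Fin n → Fin n → Bool
isTriangle T a b c = isEdge T a b ∧ isEdge T b c ∧ isEdge T a c

incident : {n : ℕ} → Fin n → Fin n → Fin n → Fin n → Bool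
incident v a b c = (toℕ v ≡ᵇ toℕ a) ∨ (toℕ v ≡ᵇ toℕ b) ∨ (toℕ v ≡ᵇ toℕ c)

trianglesAt : {n : ℕ} → Triangulation n → Fin n → ℕ
trianglesAt {n} T v =
  sum (map (λ a → sum (map (λ b → sum (map (λ c →
    if isTriangle T a b c ∧ incident v a b c then 1 else 0)
    (allFin n))) (allFin n))) (allFin n))

-- q is a quiddity of order n (n ≥ 3: from a triangulation;
-- order 2: the degenerate quiddity (0,0)).
Quiddity : (n : ℕ) → (Fin n → ℕ) → Set
Quiddity n q =
  (n ≡ 2 × (∀ i → q i ≡ 0))
  ⊎ (3 ≤ n × Σ (Triangulation n) λ T → ∀ i → q i ≡ trianglesAt T i)

ext : (n : ℕ) → (Fin n → ℕ) → ℤ → ℤ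
ext zero    q j = + 0
ext (suc k) q j = + q (fromℕ< (n%ℕd<d j (suc k)))

Array : Set
Array = ℤ → ℤ → ℤ

IsSolution : (n m : ℕ) → (Fin n → ℕ) → (Fin m → ℕ) → Array → Set
IsSolution n m q q' a =
    (∀ i j → a i j ℤ.* a (i ℤ.+ ℤ.1ℤ) (j ℤ.+ ℤ.1ℤ)
             ℤ.- a i (j ℤ.+ ℤ.1ℤ) ℤ.* a (i ℤ.+ ℤ.1ℤ) j ≡ ℤ.1ℤ)
  × (∀ i j → a i (j ℤ.+ + n) ≡ ℤ.- a i j)
  × (∀ i j → a (i ℤ.+ + m) j ≡ ℤ.- a i j)
  × (∀ (i j : ℕ) → i ℕ.< m → j ℕ.< n → ℤ.0ℤ ℤ.< a (+ i) (+ j))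
  × (∀ i j → a i (j ℤ.+ ℤ.1ℤ) ≡ ext n q j ℤ.* a i j ℤ.- a i (j ℤ.- ℤ.1ℤ))
  × (∀ i j → a (i ℤ.+ ℤ.1ℤ) j ≡ ext m q' i ℤ.* a i j ℤ.- a (i ℤ.- ℤ.1ℤ) j)

module Submission where

-- For n-periodic coefficients c, let s and t be the solutions of
-- x (j + 1) = c j * x j - x (j - 1) with (s (-1), s 0) = (-1, 0) and
-- (t (-1), t 0) = (0, 1).  Their Wronskian is constantly -1.  If c is a
-- quiddity, s and t are n-antiperiodic (the monodromy is -1) and
-- nonnegative on 0, …, n - 1; we call this finite condition admissibility.
-- Given such bases (s, t) for q and (s', t') for q', the arrays
--   a i j = (s' i + (1 + k) t' i) s j + (s' i + (2 + k) t' i) t j,   k ∈ ℕ,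
-- satisfy all requirements: each 2×2 minor is a product of two Wronskians
-- (-1)(-1) = 1, both recurrences and antiperiodicities hold by linearity,
-- entries on the fundamental box are positive, and a 0 0 = 2 + k.
--
-- The combinatorial half shows that quiddities
-- are admissible (quiddity-admissible), by induction on the polygon:
-- every triangulation has an ear, removing it yields a triangulation of a
-- smaller polygon whose quiddity changes by an ear insertion
-- (EarRemoval.ear-insertion), and ear insertions preserve admissibility
-- (insertion-admissible).

open import Data.Bool using (Bool; true; false; _∧_; _∨_; not; if_then_else_)
import Data.Bool.Properties as BoolP
open import Data.Empty using (⊥; ⊥-elim)
open import Data.Fin using (Fin; toℕ; fromℕ<; punchIn; punchOut)
import Data.Fin.Properties as FinP
open import Data.Integer as ℤ using (ℤ; +_; -[1+_]; 0ℤ; 1ℤ; -1ℤ; _+_; _-_; _*_; -_)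
open import Data.Integer.DivMod using (_%ℕ_; n%ℕd<d)
import Data.Integer.Properties as ℤP
open import Data.Integer.Tactic.RingSolver using (solve-∀)
open import Data.List using (map; allFin; tabulate)
import Data.List.Properties as ListP
open import Data.Nat as ℕ using (ℕ; zero; suc; _≤_)
open import Data.Nat.Base using (_<ᵇ_; _≡ᵇ_)
open import Data.Nat.DivMod using ([m+n]%n≡m%n; m<n⇒m%n≡m; n%n≡0)
open import Data.Nat.ListAction using (sum)
import Data.Nat.Properties as ℕP
open import Algebra.Properties.CommutativeSemigroup ℕP.+-commutativeSemigroup using (interchange; x∙yz≈y∙xz)
open import Data.Product using (Σ; ∃; ∃₂; _×_; _,_; proj₁; proj₂)
open import Data.Sum using (_⊎_; inj₁; inj₂)
open import Function using (_∘_; id)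
open import Function.Bundles using (Equivalence)
open import Relation.Binary using (tri<; tri≈; tri>)
open import Relation.Binary.PropositionalEquality
open import Relation.Nullary using (¬_; yes; no; Dec)
open import Relation.Nullary.Decidable using (_×-dec_)

open import Defs

ℤ-induction : (P : ℤ → Set) → P 0ℤ → (∀ j → P j → P (j + 1ℤ)) → (∀ j → P j → P (j - 1ℤ)) →
              ∀ j → P j
ℤ-induction P p0 up down (+ k) = nonneg k
  where
  nonneg : ∀ k → P (+ k)
  nonneg zero    = p0
  nonneg (suc k) = subst P (cong +_ (ℕP.+-comm k 1)) (up (+ k) (nonneg k))
ℤ-induction P p0 up down -[1+ k ] = neg k
  where
  neg : ∀ k → P -[1+ k ]
  neg zero    = down 0ℤ p0
  neg (suc k) = subst P (cong (λ x → -[1+ suc x ]) (ℕP.+-identityʳ k)) (down -[1+ k ] (neg k))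

a≡b-[b-a] : ∀ b a → a ≡ b - (b - a)
a≡b-[b-a] = solve-∀

Recurrence : (ℤ → ℤ) → (ℤ → ℤ) → Set
Recurrence c x = ∀ j → x (j + 1ℤ) ≡ c j * x j - x (j - 1ℤ)

recurrence-backwards : ∀ c x → Recurrence c x → ∀ j → x (j - 1ℤ) ≡ c j * x j - x (j + 1ℤ)
recurrence-backwards c x rx j = begin
  x (j - 1ℤ)                           ≡⟨ a≡b-[b-a] (c j * x j) (x (j - 1ℤ)) ⟩
  c j * x j - (c j * x j - x (j - 1ℤ)) ≡⟨ cong (λ y → c j * x j - y) (sym (rx j)) ⟩
  c j * x j - x (j + 1ℤ)               ∎
  where open ≡-Reasoning

-- Continuants: cont c u v k = x (k - 1) for the solution on j ≥ -1 of
-- x (j + 1) = c j * x j - x (j - 1) with x (-1) = u and x 0 = v.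
cont : (ℕ → ℤ) → ℤ → ℤ → ℕ → ℤ
cont c u v zero          = u
cont c u v (suc zero)    = v
cont c u v (suc (suc k)) = c k * cont c u v (suc k) - cont c u v k

cont-cong : ∀ {c c'} u v → (∀ k → c k ≡ c' k) → ∀ k → cont c u v k ≡ cont c' u v k
cont-cong u v e zero          = refl
cont-cong u v e (suc zero)    = refl
cont-cong u v e (suc (suc k)) =
  cong₂ _-_ (cong₂ _*_ (e k) (cont-cong u v e (suc k))) (cont-cong u v e k)

-- The solution on ℤ with x (-1) = u and x 0 = v: the continuants forwards,
-- and on the negative integers the continuants of the reversed recurrence
-- y k = x (- k), whose coefficients are c (- 1 - k).
solution : (ℤ → ℤ) → ℤ → ℤ → ℤ → ℤ
solution c u v (+ k)    = cont (λ i → c (+ i)) u v (suc k)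
solution c u v -[1+ k ] = cont (λ i → c -[1+ i ]) v u (suc k)

solution-rec : ∀ c u v → Recurrence c (solution c u v)
solution-rec c u v (+ zero)      = refl
solution-rec c u v (+ suc k) rewrite ℕP.+-comm k 1 = refl
solution-rec c u v -[1+ zero ]   = a≡b-[b-a] (c -1ℤ * u) v
solution-rec c u v -[1+ suc k ] rewrite ℕP.+-identityʳ k =
  a≡b-[b-a] (c -[1+ suc k ] * solution c u v -[1+ suc k ]) (solution c u v -[1+ k ])

recurrence-unique : ∀ c x y → Recurrence c x → Recurrence c y →
                    x 0ℤ ≡ y 0ℤ → x 1ℤ ≡ y 1ℤ → ∀ j → x j ≡ y j
recurrence-unique c x y rx ry e0 e1 j = proj₁ (ℤ-induction Agree (e0 , e1) up down j)
  where
  Agree : ℤ → Set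
  Agree j = x j ≡ y j × x (j + 1ℤ) ≡ y (j + 1ℤ)
  j+1-1 : ∀ j → j + 1ℤ - 1ℤ ≡ j
  j+1-1 = solve-∀
  j-1+1 : ∀ j → j - 1ℤ + 1ℤ ≡ j
  j-1+1 = solve-∀
  up : ∀ j → Agree j → Agree (j + 1ℤ)
  up j (ej , ej+1) = ej+1 , (begin
    x (j + 1ℤ + 1ℤ)                                ≡⟨ rx (j + 1ℤ) ⟩
    c (j + 1ℤ) * x (j + 1ℤ) - x (j + 1ℤ - 1ℤ)       ≡⟨ cong₂ (λ u v → c (j + 1ℤ) * u - v) ej+1
                                                        (trans (cong x (j+1-1 j)) (trans ej (cong y (sym (j+1-1 j))))) ⟩
    c (j + 1ℤ) * y (j + 1ℤ) - y (j + 1ℤ - 1ℤ)       ≡⟨ sym (ry (j + 1ℤ)) ⟩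
    y (j + 1ℤ + 1ℤ)                                ∎)
    where open ≡-Reasoning
  down : ∀ j → Agree j → Agree (j - 1ℤ)
  down j (ej , ej+1) = (begin
    x (j - 1ℤ)               ≡⟨ recurrence-backwards c x rx j ⟩
    c j * x j - x (j + 1ℤ)   ≡⟨ cong₂ (λ u v → c j * u - v) ej ej+1 ⟩
    c j * y j - y (j + 1ℤ)   ≡⟨ sym (recurrence-backwards c y ry j) ⟩
    y (j - 1ℤ)               ∎) , trans (cong x (j-1+1 j)) (trans ej (cong y (sym (j-1+1 j))))
    where open ≡-Reasoning

W : (ℤ → ℤ) → (ℤ → ℤ) → ℤ → ℤ
W x y j = x j * y (j + 1ℤ) - x (j + 1ℤ) * y j

wronskian-constant : ∀ c x y → Recurrence c x → Recurrence c y → ∀ j → W x y j ≡ W x y 0ℤ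
wronskian-constant c x y rx ry = ℤ-induction (λ j → W x y j ≡ W x y 0ℤ) refl up down
  where
  step : ∀ C X0 X1 Y0 Y1 → X1 * (C * Y1 - Y0) - (C * X1 - X0) * Y1 ≡ X0 * Y1 - X1 * Y0
  step = solve-∀
  j+1-1 : ∀ j → j + 1ℤ - 1ℤ ≡ j
  j+1-1 = solve-∀
  j-1+1 : ∀ j → j - 1ℤ + 1ℤ ≡ j
  j-1+1 = solve-∀
  shift : ∀ j → W x y (j + 1ℤ) ≡ W x y j
  shift j = begin
    x (j + 1ℤ) * y (j + 1ℤ + 1ℤ) - x (j + 1ℤ + 1ℤ) * y (j + 1ℤ)
      ≡⟨ cong₂ (λ u v → x (j + 1ℤ) * u - v * y (j + 1ℤ))
           (trans (ry (j + 1ℤ)) (cong (λ i → c (j + 1ℤ) * y (j + 1ℤ) - y i) (j+1-1 j)))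
           (trans (rx (j + 1ℤ)) (cong (λ i → c (j + 1ℤ) * x (j + 1ℤ) - x i) (j+1-1 j))) ⟩
    x (j + 1ℤ) * (c (j + 1ℤ) * y (j + 1ℤ) - y j) - (c (j + 1ℤ) * x (j + 1ℤ) - x j) * y (j + 1ℤ)
      ≡⟨ step (c (j + 1ℤ)) (x j) (x (j + 1ℤ)) (y j) (y (j + 1ℤ)) ⟩
    W x y j ∎
    where open ≡-Reasoning
  up : ∀ j → W x y j ≡ W x y 0ℤ → W x y (j + 1ℤ) ≡ W x y 0ℤ
  up j e = trans (shift j) e
  down : ∀ j → W x y j ≡ W x y 0ℤ → W x y (j - 1ℤ) ≡ W x y 0ℤ
  down j e = trans (sym (trans (cong (W x y) (sym (j-1+1 j))) (shift (j - 1ℤ)))) e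

recurrence-lin : ∀ c x y a b → Recurrence c x → Recurrence c y → Recurrence c (λ j → a * x j + b * y j)
recurrence-lin c x y a b rx ry j = begin
  a * x (j + 1ℤ) + b * y (j + 1ℤ)
    ≡⟨ cong₂ (λ u v → a * u + b * v) (rx j) (ry j) ⟩
  a * (c j * x j - x (j - 1ℤ)) + b * (c j * y j - y (j - 1ℤ))
    ≡⟨ distribute a b (c j) (x j) (x (j - 1ℤ)) (y j) (y (j - 1ℤ)) ⟩
  c j * (a * x j + b * y j) - (a * x (j - 1ℤ) + b * y (j - 1ℤ)) ∎
  where
  open ≡-Reasoning
  distribute : ∀ a b C X0 Xm Y0 Ym → a * (C * X0 - Xm) + b * (C * Y0 - Ym) ≡ C * (a * X0 + b * Y0) - (a * Xm + b * Ym)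
  distribute = solve-∀

recurrence-neg : ∀ c x → Recurrence c x → Recurrence c (λ j → - x j)
recurrence-neg c x rx j = trans (cong -_ (rx j)) (negate (c j) (x j) (x (j - 1ℤ)))
  where
  negate : ∀ C X0 Xm → - (C * X0 - Xm) ≡ C * (- X0) - (- Xm)
  negate = solve-∀

recurrence-shift : ∀ c x n → (∀ j → c (j + n) ≡ c j) → Recurrence c x → Recurrence c (λ j → x (j + n))
recurrence-shift c x n per rx j = begin
  x (j + 1ℤ + n)                        ≡⟨ cong x (comm₁ j n) ⟩
  x (j + n + 1ℤ)                        ≡⟨ rx (j + n) ⟩
  c (j + n) * x (j + n) - x (j + n - 1ℤ) ≡⟨ cong₂ (λ u i → u * x (j + n) - x i) (per j) (sym (comm₂ j n)) ⟩
  c j * x (j + n) - x (j - 1ℤ + n)       ∎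
  where
  open ≡-Reasoning
  comm₁ : ∀ j n → j + 1ℤ + n ≡ j + n + 1ℤ
  comm₁ = solve-∀
  comm₂ : ∀ j n → j - 1ℤ + n ≡ j + n - 1ℤ
  comm₂ = solve-∀

fromℕ<-cong : ∀ {a b d} (p : a ℕ.< d) (p' : b ℕ.< d) → a ≡ b → fromℕ< p ≡ fromℕ< p'
fromℕ<-cong p p' refl = refl

complement : ℕ → ℕ → ℕ
complement d zero    = 0
complement d (suc r) = d ℕ.∸ suc r

neg-%ℕ : ∀ d a → -[1+ a ] %ℕ suc d ≡ complement (suc d) (suc a ℕ.% suc d)
neg-%ℕ d a with suc a ℕ.% suc d
... | zero  = refl
... | suc r = refl

%ℕ-periodic : ∀ d j → (j + + suc d) %ℕ suc d ≡ j %ℕ suc d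
%ℕ-periodic d (+ k) = [m+n]%n≡m%n k (suc d)
%ℕ-periodic d -[1+ k ] with ℕP.<-cmp (suc k) (suc d)
... | tri< k<d _ _ = begin
  (suc d ℤ.⊖ suc k) %ℕ suc d          ≡⟨ cong (_%ℕ suc d) (ℤP.≤-⊖ (ℕP.<⇒≤ k<d)) ⟩
  (suc d ℕ.∸ suc k) ℕ.% suc d          ≡⟨ m<n⇒m%n≡m (ℕP.∸-monoʳ-< {suc d} {suc k} {0} (ℕ.s≤s ℕ.z≤n) (ℕP.<⇒≤ k<d)) ⟩
  suc d ℕ.∸ suc k                      ≡⟨ cong (complement (suc d)) (sym (m<n⇒m%n≡m k<d)) ⟩
  complement (suc d) (suc k ℕ.% suc d) ≡⟨ sym (neg-%ℕ d k) ⟩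
  -[1+ k ] %ℕ suc d                    ∎
  where open ≡-Reasoning
... | tri≈ _ refl _ = trans (cong (_%ℕ suc d) (ℤP.n⊖n≡0 (suc d)))
                            (sym (trans (neg-%ℕ d k) (cong (complement (suc d)) (n%n≡0 (suc d)))))
... | tri> _ _ d<k = begin
  (suc d ℤ.⊖ suc k) %ℕ suc d                  ≡⟨ cong (_%ℕ suc d) (trans (ℤP.⊖-< d<k) as-neg) ⟩
  -[1+ k ℕ.∸ suc d ] %ℕ suc d                 ≡⟨ neg-%ℕ d (k ℕ.∸ suc d) ⟩
  complement (suc d) (suc (k ℕ.∸ suc d) ℕ.% suc d) ≡⟨ cong (complement (suc d)) same-residue ⟩
  complement (suc d) (suc k ℕ.% suc d)         ≡⟨ sym (neg-%ℕ d k) ⟩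
  -[1+ k ] %ℕ suc d                           ∎
  where
  open ≡-Reasoning
  d≤k : suc d ℕ.≤ k
  d≤k = ℕP.≤-pred d<k
  suc-∸ : suc k ℕ.∸ suc d ≡ suc (k ℕ.∸ suc d)
  suc-∸ = ℕP.+-∸-assoc 1 d≤k
  as-neg : - (+ (suc k ℕ.∸ suc d)) ≡ -[1+ k ℕ.∸ suc d ]
  as-neg rewrite suc-∸ = refl
  same-residue : suc (k ℕ.∸ suc d) ℕ.% suc d ≡ suc k ℕ.% suc d
  same-residue = trans (sym ([m+n]%n≡m%n (suc (k ℕ.∸ suc d)) (suc d)))
    (cong (ℕ._% suc d) (trans (cong (ℕ._+ suc d) (sym suc-∸)) (ℕP.m∸n+n≡m (ℕP.≤-trans d≤k (ℕP.n≤1+n k)))))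

ext-periodic : ∀ n q j → ext n q (j + + n) ≡ ext n q j
ext-periodic zero    q j = refl
ext-periodic (suc d) q j =
  cong (λ v → + q v) (fromℕ<-cong (n%ℕd<d (j + + suc d) (suc d)) (n%ℕd<d j (suc d)) (%ℕ-periodic d j))

ext-cong : ∀ n {q q' : Fin n → ℕ} → (∀ i → q i ≡ q' i) → ∀ j → ext n q j ≡ ext n q' j
ext-cong zero    e j = refl
ext-cong (suc n) e j = cong +_ (e _)

ext-at : ∀ n q (v : Fin n) → ext n q (+ toℕ v) ≡ + q v
ext-at (suc d) q v = cong (λ v → + q v)
  (trans (fromℕ<-cong (n%ℕd<d (+ toℕ v) (suc d)) (FinP.toℕ<n v) (m<n⇒m%n≡m (FinP.toℕ<n v)))
         (FinP.fromℕ<-toℕ v (FinP.toℕ<n v)))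

-- The two fundamental solutions as continuants: s with (s (-1), s 0) = (-1, 0)
-- and t with (t (-1), t 0) = (0, 1); so fundS c (1 + j) = s j.
fundS fundT : (ℕ → ℤ) → ℕ → ℤ
fundS c = cont c -1ℤ 0ℤ
fundT c = cont c 0ℤ 1ℤ

-- The finite data making the fundamental solutions of a recurrence with
-- n-periodic coefficients c antiperiodic of period n: at n - 1 and n they
-- take minus their values at -1 and 0 (the monodromy is -1), and they are
-- nonnegative on 0, …, n - 1.  Quiddities satisfy this
-- (quiddity-admissible below).
record Admissible (n : ℕ) (c : ℕ → ℤ) : Set where
  field
    s-last : fundS c n ≡ 1ℤ
    s-end  : fundS c (suc n) ≡ 0ℤ
    t-last : fundT c n ≡ 0ℤ
    t-end  : fundT c (suc n) ≡ -1ℤ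
    nonneg : ∀ j → j ℕ.< n → 0ℤ ℤ.≤ fundS c (suc j) × 0ℤ ℤ.≤ fundT c (suc j)

admissible-cong : ∀ {n c c'} → (∀ k → c k ≡ c' k) → Admissible n c → Admissible n c'
admissible-cong {n} {c} {c'} e adm = record
  { s-last = trans (sym (sameS n)) s-last
  ; s-end  = trans (sym (sameS (suc n))) s-end
  ; t-last = trans (sym (sameT n)) t-last
  ; t-end  = trans (sym (sameT (suc n))) t-end
  ; nonneg = λ j j<n → subst (0ℤ ℤ.≤_) (sameS (suc j)) (proj₁ (nonneg j j<n))
                     , subst (0ℤ ℤ.≤_) (sameT (suc j)) (proj₂ (nonneg j j<n))
  }
  where
  open Admissible adm
  sameS : ∀ k → fundS c k ≡ fundS c' k
  sameS = cont-cong -1ℤ 0ℤ e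
  sameT : ∀ k → fundT c k ≡ fundT c' k
  sameT = cont-cong 0ℤ 1ℤ e

record AntiperiodicBasis (n : ℕ) (c : ℤ → ℤ) : Set where
  field
    s t       : ℤ → ℤ
    s-rec     : Recurrence c s
    t-rec     : Recurrence c t
    s0        : s 0ℤ ≡ 0ℤ
    t0        : t 0ℤ ≡ 1ℤ
    s-anti    : ∀ j → s (j + + n) ≡ - s j
    t-anti    : ∀ j → t (j + + n) ≡ - t j
    nonneg    : ∀ j → j ℕ.< n → 0ℤ ℤ.≤ s (+ j) × 0ℤ ℤ.≤ t (+ j)
    wronskian : ∀ j → W s t j ≡ -1ℤ

-- For n-periodic coefficients, admissibility yields an antiperiodic basis:
-- x ↦ x (· + n) and x ↦ - x are solutions agreeing at 0 and 1.
antiperiodic-basis : ∀ n₁ q → Admissible (suc n₁) (λ k → ext (suc n₁) q (+ k)) →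
                     AntiperiodicBasis (suc n₁) (ext (suc n₁) q)
antiperiodic-basis n₁ q adm = record
  { s = s ; t = t ; s-rec = s-rec ; t-rec = t-rec ; s0 = refl ; t0 = refl
  ; s-anti = recurrence-unique c (λ j → s (j + + n)) (λ j → - s j)
      (recurrence-shift c s (+ n) (ext-periodic n q) s-rec) (recurrence-neg c s s-rec)
      s-end
      (trans (cong₂ (λ u v → c (+ n) * u - v) s-end s-last)
             (trans (C*0-1 (c (+ n))) (cong -_ (sym (s₁ (c 0ℤ))))))
  ; t-anti = recurrence-unique c (λ j → t (j + + n)) (λ j → - t j)
      (recurrence-shift c t (+ n) (ext-periodic n q) t-rec) (recurrence-neg c t t-rec)
      t-end
      (trans (cong₂ (λ u v → c (+ n) * u - v) t-end t-last)
             (trans (C*-1-0 (c (+ n))) (cong -_ (trans (ext-periodic n q 0ℤ) (sym (t₁ (c 0ℤ)))))))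
  ; nonneg = nonneg
  ; wronskian = λ j → trans (wronskian-constant c s t s-rec t-rec j) (W₀ (c 0ℤ))
  }
  where
  open Admissible adm
  n : ℕ
  n = suc n₁
  c : ℤ → ℤ
  c = ext n q
  s t : ℤ → ℤ
  s = solution c -1ℤ 0ℤ
  t = solution c 0ℤ 1ℤ
  s-rec : Recurrence c s
  s-rec = solution-rec c -1ℤ 0ℤ
  t-rec : Recurrence c t
  t-rec = solution-rec c 0ℤ 1ℤ
  C*0-1 : ∀ C → C * 0ℤ - 1ℤ ≡ - 1ℤ
  C*0-1 = solve-∀
  C*-1-0 : ∀ C → C * (- 1ℤ) - 0ℤ ≡ - C
  C*-1-0 = solve-∀
  s₁ : ∀ C → C * 0ℤ - -1ℤ ≡ 1ℤ
  s₁ = solve-∀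
  t₁ : ∀ C → C * 1ℤ - 0ℤ ≡ C
  t₁ = solve-∀
  W₀ : ∀ C → 0ℤ * (C * 1ℤ - 0ℤ) - (C * 0ℤ - -1ℤ) * 1ℤ ≡ -1ℤ
  W₀ = solve-∀

positive-combination : ∀ (α β x y : ℤ) → 0ℤ ℤ.< α → 0ℤ ℤ.< β → 0ℤ ℤ.≤ x → 0ℤ ℤ.≤ y →
                       ¬ (x ≡ 0ℤ × y ≡ 0ℤ) → 0ℤ ℤ.< α * x + β * y
positive-combination (+ zero) _ _ _ (ℤ.+<+ ()) _ _ _ _
positive-combination (+ suc _) (+ zero) _ _ _ (ℤ.+<+ ()) _ _ _
positive-combination (+ suc α) (+ suc β) (+ a) (+ b) _ _ _ _ nz =
  subst (0ℤ ℤ.<_) (trans (ℤP.pos-+ (suc α ℕ.* a) (suc β ℕ.* b))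
                         (cong₂ _+_ (ℤP.pos-* (suc α) a) (ℤP.pos-* (suc β) b)))
        (on-ℕ a b nz)
  where
  on-ℕ : ∀ a b → ¬ (+ a ≡ 0ℤ × + b ≡ 0ℤ) → 0ℤ ℤ.< + (suc α ℕ.* a ℕ.+ suc β ℕ.* b)
  on-ℕ (suc a) b    _  = ℤ.+<+ (ℕ.s≤s ℕ.z≤n)
  on-ℕ zero (suc b) _  rewrite ℕP.*-zeroʳ α = ℤ.+<+ (ℕ.s≤s ℕ.z≤n)
  on-ℕ zero zero    nz = ⊥-elim (nz (refl , refl))

0<suc : ∀ k → 0ℤ ℤ.< + suc k
0<suc k = ℤ.+<+ (ℕ.s≤s ℕ.z≤n)

-- Wronskian -1 forbids a common zero of s and t.
no-common-zero : ∀ {n c} (B : AntiperiodicBasis n c) j →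
                 ¬ (AntiperiodicBasis.s B j ≡ 0ℤ × AntiperiodicBasis.t B j ≡ 0ℤ)
no-common-zero B j (s≡0 , t≡0) = 0≢-1 (begin
  0ℤ                                                       ≡⟨ sym (0*X-Y*0 (t (j + 1ℤ)) (s (j + 1ℤ))) ⟩
  0ℤ * t (j + 1ℤ) - s (j + 1ℤ) * 0ℤ                         ≡⟨ cong₂ (λ u v → u * t (j + 1ℤ) - s (j + 1ℤ) * v) (sym s≡0) (sym t≡0) ⟩
  W s t j                                                  ≡⟨ wronskian j ⟩
  -1ℤ                                                      ∎)
  where
  open AntiperiodicBasis B
  open ≡-Reasoning
  0*X-Y*0 : ∀ X Y → 0ℤ * X - Y * 0ℤ ≡ 0ℤ
  0*X-Y*0 = solve-∀
  0≢-1 : 0ℤ ≡ -1ℤ → ⊥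
  0≢-1 ()

module Array-k {n m : ℕ} {c c' : ℤ → ℤ}
               (B : AntiperiodicBasis n c) (B' : AntiperiodicBasis m c') (k : ℕ) where
  open AntiperiodicBasis B
  module B' = AntiperiodicBasis B'

  β δ : ℤ
  β = 1ℤ + + k
  δ = 1ℤ + β

  P Q : ℤ → ℤ
  P i = 1ℤ * B'.s i + β * B'.t i
  Q i = 1ℤ * B'.s i + δ * B'.t i

  a : Array
  a i j = P i * s j + Q i * t j

  -- The unimodular change of basis keeps the Wronskian -1 ...
  W-PQ : ∀ i → W P Q i ≡ -1ℤ
  W-PQ i = trans (change-of-basis (+ k) (B'.s i) (B'.s (i + 1ℤ)) (B'.t i) (B'.t (i + 1ℤ))) (B'.wronskian i)
    where
    change-of-basis : ∀ K s0 s1 t0 t1 →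
      (1ℤ * s0 + (1ℤ + K) * t0) * (1ℤ * s1 + (1ℤ + (1ℤ + K)) * t1)
        - (1ℤ * s1 + (1ℤ + K) * t1) * (1ℤ * s0 + (1ℤ + (1ℤ + K)) * t0) ≡ s0 * t1 - s1 * t0
    change-of-basis = solve-∀

  -- ... and each 2×2 minor is the product of the two Wronskians.
  unimodular : ∀ i j → a i j * a (i + 1ℤ) (j + 1ℤ) - a i (j + 1ℤ) * a (i + 1ℤ) j ≡ 1ℤ
  unimodular i j = begin
    a i j * a (i + 1ℤ) (j + 1ℤ) - a i (j + 1ℤ) * a (i + 1ℤ) j
      ≡⟨ minor (P i) (P (i + 1ℤ)) (Q i) (Q (i + 1ℤ)) (s j) (s (j + 1ℤ)) (t j) (t (j + 1ℤ)) ⟩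
    W P Q i * W s t j
      ≡⟨ cong₂ _*_ (W-PQ i) (wronskian j) ⟩
    1ℤ ∎
    where
    open ≡-Reasoning
    minor : ∀ p0 p1 q0 q1 s0 s1 t0 t1 →
      (p0 * s0 + q0 * t0) * (p1 * s1 + q1 * t1) - (p0 * s1 + q0 * t1) * (p1 * s0 + q1 * t0)
        ≡ (p0 * q1 - p1 * q0) * (s0 * t1 - s1 * t0)
    minor = solve-∀

  anti-columns : ∀ i j → a i (j + + n) ≡ - a i j
  anti-columns i j = trans (cong₂ (λ u v → P i * u + Q i * v) (s-anti j) (t-anti j))
                           (negate (P i) (Q i) (s j) (t j))
    where
    negate : ∀ p q x y → p * (- x) + q * (- y) ≡ - (p * x + q * y)
    negate = solve-∀

  anti-rows : ∀ i j → a (i + + m) j ≡ - a i j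
  anti-rows i j = trans (cong₂ (λ u v → (1ℤ * u + β * v) * s j + (1ℤ * u + δ * v) * t j) (B'.s-anti i) (B'.t-anti i))
                        (negate β δ (B'.s i) (B'.t i) (s j) (t j))
    where
    negate : ∀ β δ x y S T → (1ℤ * (- x) + β * (- y)) * S + (1ℤ * (- x) + δ * (- y)) * T
                           ≡ - ((1ℤ * x + β * y) * S + (1ℤ * x + δ * y) * T)
    negate = solve-∀

  rec-columns : ∀ i j → a i (j + 1ℤ) ≡ c j * a i j - a i (j - 1ℤ)
  rec-columns i = recurrence-lin c s t (P i) (Q i) s-rec t-rec

  rec-rows : ∀ i j → a (i + 1ℤ) j ≡ c' i * a i j - a (i - 1ℤ) j
  rec-rows i j = trans (cong₂ (λ u v → u * s j + v * t j) (P-rec i) (Q-rec i))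
                       (regroup (c' i) (P i) (P (i - 1ℤ)) (Q i) (Q (i - 1ℤ)) (s j) (t j))
    where
    P-rec : Recurrence c' P
    P-rec = recurrence-lin c' B'.s B'.t 1ℤ β B'.s-rec B'.t-rec
    Q-rec : Recurrence c' Q
    Q-rec = recurrence-lin c' B'.s B'.t 1ℤ δ B'.s-rec B'.t-rec
    regroup : ∀ C P0 Pm Q0 Qm S T → (C * P0 - Pm) * S + (C * Q0 - Qm) * T ≡ C * (P0 * S + Q0 * T) - (Pm * S + Qm * T)
    regroup = solve-∀

  -- On the fundamental box P, Q > 0 and (s j, t j) is a nonzero nonnegative pair.
  positive : ∀ (i j : ℕ) → i ℕ.< m → j ℕ.< n → 0ℤ ℤ.< a (+ i) (+ j)
  positive i j i<m j<n = positive-combination (P (+ i)) (Q (+ i)) (s (+ j)) (t (+ j)) (row-positive β (0<suc k)) (row-positive δ (0<suc (suc k)))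
    (proj₁ (nonneg j j<n)) (proj₂ (nonneg j j<n)) (no-common-zero B (+ j))
    where
    row-positive : ∀ γ → 0ℤ ℤ.< γ → 0ℤ ℤ.< 1ℤ * B'.s (+ i) + γ * B'.t (+ i)
    row-positive γ 0<γ = positive-combination 1ℤ γ (B'.s (+ i)) (B'.t (+ i)) (0<suc 0) 0<γ
      (proj₁ (B'.nonneg i i<m)) (proj₂ (B'.nonneg i i<m)) (no-common-zero B' (+ i))

  -- The corner entry tells the arrays apart.
  corner : a 0ℤ 0ℤ ≡ + suc (suc k)
  corner = trans (cong₂ (λ u v → (1ℤ * u + β * v) * s 0ℤ + (1ℤ * u + δ * v) * t 0ℤ) B'.s0 B'.t0)
                 (trans (cong₂ (λ u v → (1ℤ * 0ℤ + β * 1ℤ) * u + (1ℤ * 0ℤ + δ * 1ℤ) * v) s0 t0) (evaluate β δ))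
    where
    evaluate : ∀ β δ → (1ℤ * 0ℤ + β * 1ℤ) * 0ℤ + (1ℤ * 0ℤ + δ * 1ℤ) * 1ℤ ≡ δ
    evaluate = solve-∀

arrays-from-admissible : ∀ n₁ m₁ q q' →
  Admissible (suc n₁) (λ k → ext (suc n₁) q (+ k)) → Admissible (suc m₁) (λ k → ext (suc m₁) q' (+ k)) →
  Σ (ℕ → Array) λ A →
    (∀ k → IsSolution (suc n₁) (suc m₁) q q' (A k))
    × (∀ k l → ¬ k ≡ l → ∃₂ λ (i j : ℤ) → ¬ A k i j ≡ A l i j)
arrays-from-admissible n₁ m₁ q q' adm adm' =
  Array-k.a B B' ,
  (λ k → let open Array-k B B' k in unimodular , anti-columns , anti-rows , positive , rec-columns , rec-rows) ,
  λ k l k≢l → 0ℤ , 0ℤ , λ e → k≢l (ℕP.suc-injective (ℕP.suc-injective (ℤP.+-injective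
                 (trans (sym (Array-k.corner B B' k)) (trans e (Array-k.corner B B' l))))))
  where
  B : AntiperiodicBasis (suc n₁) (ext (suc n₁) q)
  B = antiperiodic-basis n₁ q adm
  B' : AntiperiodicBasis (suc m₁) (ext (suc m₁) q')
  B' = antiperiodic-basis m₁ q' adm'

-- This is how
-- the quiddity of a triangulated polygon changes when an ear is glued on.
record EarInsertion (n p : ℕ) (c c' : ℕ → ℤ) : Set where
  field
    room   : suc p ℕ.< n
    before : ∀ j → j ℕ.< p → c j ≡ c' j
    left   : c p ≡ c' p + 1ℤ
    ear    : c (suc p) ≡ 1ℤ
    right  : c (suc (suc p)) ≡ c' (suc p) + 1ℤ
    after  : ∀ j → suc (suc p) ℕ.≤ j → j ℕ.< n → c (suc j) ≡ c' j

module InsertionContinuants {n p c c'} (I : EarInsertion n p c c') (u v : ℤ) where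
  open EarInsertion I

  R R' : ℕ → ℤ
  R  = cont c u v
  R' = cont c' u v

  prefix : ∀ k → k ℕ.≤ suc p → R k ≡ R' k
  prefix zero          _         = refl
  prefix (suc zero)    _         = refl
  prefix (suc (suc j)) (ℕ.s≤s h) =
    cong₂ (λ C (rs : ℤ × ℤ) → C * proj₁ rs - proj₂ rs) (before j h)
          (cong₂ _,_ (prefix (suc j) (ℕP.m≤n⇒m≤1+n h)) (prefix j (ℕP.≤-trans (ℕP.n≤1+n j) (ℕP.m≤n⇒m≤1+n h))))

  middle : R (suc (suc p)) ≡ R' (suc p) + R' (suc (suc p))
  middle = begin
    c p * R (suc p) - R p                  ≡⟨ cong₂ (λ C (rs : ℤ × ℤ) → C * proj₁ rs - proj₂ rs) left
                                                     (cong₂ _,_ (prefix (suc p) ℕP.≤-refl) (prefix p (ℕP.n≤1+n p))) ⟩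
    (c' p + 1ℤ) * R' (suc p) - R' p        ≡⟨ split (c' p) (R' (suc p)) (R' p) ⟩
    R' (suc p) + (c' p * R' (suc p) - R' p) ∎
    where
    open ≡-Reasoning
    split : ∀ C A B → (C + 1ℤ) * A - B ≡ A + (C * A - B)
    split = solve-∀

  private
    suffix′ : ∀ d → d ℕ.+ suc (suc p) ℕ.≤ suc n → R (suc (d ℕ.+ suc (suc p))) ≡ R' (d ℕ.+ suc (suc p))
    suffix′ zero _ = begin
      c (suc p) * R (suc (suc p)) - R (suc p)              ≡⟨ cong₂ (λ C (rs : ℤ × ℤ) → C * proj₁ rs - proj₂ rs) ear
                                                                  (cong₂ _,_ middle (prefix (suc p) ℕP.≤-refl)) ⟩
      1ℤ * (R' (suc p) + R' (suc (suc p))) - R' (suc p)    ≡⟨ cancel (R' (suc p)) (R' (suc (suc p))) ⟩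
      R' (suc (suc p))                                     ∎
      where
      open ≡-Reasoning
      cancel : ∀ A B → 1ℤ * (A + B) - A ≡ B
      cancel = solve-∀
    suffix′ (suc zero) h = begin
      c (suc (suc p)) * R (suc (suc (suc p))) - R (suc (suc p))
        ≡⟨ cong₂ (λ C (rs : ℤ × ℤ) → C * proj₁ rs - proj₂ rs) right (cong₂ _,_ (suffix′ zero (ℕP.≤-trans (ℕP.n≤1+n _) h)) middle) ⟩
      (c' (suc p) + 1ℤ) * R' (suc (suc p)) - (R' (suc p) + R' (suc (suc p)))
        ≡⟨ cancel (c' (suc p)) (R' (suc p)) (R' (suc (suc p))) ⟩
      c' (suc p) * R' (suc (suc p)) - R' (suc p)
        ∎
      where
      open ≡-Reasoning
      cancel : ∀ C A B → (C + 1ℤ) * B - (A + B) ≡ C * B - A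
      cancel = solve-∀
    suffix′ (suc (suc d)) h =
      cong₂ (λ C (rs : ℤ × ℤ) → C * proj₁ rs - proj₂ rs)
            (after k (ℕP.m≤n+m (suc (suc p)) d) (ℕP.≤-pred h))
            (cong₂ _,_ (suffix′ (suc d) (ℕP.≤-trans (ℕP.n≤1+n _) h))
                       (suffix′ d (ℕP.≤-trans (ℕP.n≤1+n _) (ℕP.≤-trans (ℕP.n≤1+n _) h))))
      where k = d ℕ.+ suc (suc p)

  suffix : ∀ k → suc (suc p) ℕ.≤ k → k ℕ.≤ suc n → R (suc k) ≡ R' k
  suffix k p+2≤k k≤n+1 = subst (λ i → R (suc i) ≡ R' i) (ℕP.m∸n+n≡m p+2≤k)
    (suffix′ (k ℕ.∸ suc (suc p)) (subst (ℕ._≤ suc n) (sym (ℕP.m∸n+n≡m p+2≤k)) k≤n+1))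

  nonneg-preserved : (∀ j → j ℕ.< n → 0ℤ ℤ.≤ R' (suc j)) → ∀ j → j ℕ.< suc n → 0ℤ ℤ.≤ R (suc j)
  nonneg-preserved nonneg' j j<n+1 with ℕP.<-cmp j (suc p)
  ... | tri< j≤p _ _ = subst (0ℤ ℤ.≤_) (sym (prefix (suc j) j≤p))
                             (nonneg' j (ℕP.<-trans j≤p room))
  ... | tri≈ _ refl _ = subst (0ℤ ℤ.≤_) (sym middle)
                             (ℤP.+-mono-≤ (nonneg' p (ℕP.<-trans (ℕP.n<1+n p) room)) (nonneg' (suc p) room))
  nonneg-preserved nonneg' (suc j) j<n+1 | tri> _ _ p+1<j+1 =
    subst (0ℤ ℤ.≤_) (sym (suffix (suc j) p+1<j+1 (ℕP.<⇒≤ j<n+1))) (nonneg' j (ℕP.≤-pred j<n+1))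

insertion-admissible : ∀ {n p c c'} → EarInsertion n p c c' → Admissible n c' → Admissible (suc n) c
insertion-admissible {n} {p} I adm = record
  { s-last = trans (S.suffix n room (ℕP.n≤1+n n)) s-last
  ; s-end  = trans (S.suffix (suc n) (ℕP.≤-trans room (ℕP.n≤1+n n)) ℕP.≤-refl) s-end
  ; t-last = trans (T.suffix n room (ℕP.n≤1+n n)) t-last
  ; t-end  = trans (T.suffix (suc n) (ℕP.≤-trans room (ℕP.n≤1+n n)) ℕP.≤-refl) t-end
  ; nonneg = λ j j<n+1 → S.nonneg-preserved (λ i i<n → proj₁ (nonneg i i<n)) j j<n+1
                       , T.nonneg-preserved (λ i i<n → proj₂ (nonneg i i<n)) j j<n+1
  }
  where
  open EarInsertion I
  open Admissible adm
  module S = InsertionContinuants I -1ℤ 0ℤ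
  module T = InsertionContinuants I 0ℤ 1ℤ

∧-split : ∀ {a b} → a ∧ b ≡ true → a ≡ true × b ≡ true
∧-split {true} {true} _ = refl , refl

∧-pair : ∀ {a b} → a ≡ true → b ≡ true → a ∧ b ≡ true
∧-pair refl refl = refl

∨-split : ∀ {a b} → a ∨ b ≡ true → a ≡ true ⊎ b ≡ true
∨-split {true}  _ = inj₁ refl
∨-split {false} e = inj₂ e

∨-inl : ∀ {a} b → a ≡ true → a ∨ b ≡ true
∨-inl b refl = refl

∨-inr : ∀ a {b} → b ≡ true → a ∨ b ≡ true
∨-inr a refl = BoolP.∨-zeroʳ a

∨-false : ∀ {a b} → a ≡ false → b ≡ false → a ∨ b ≡ false
∨-false refl refl = refl

true≢false : true ≢ false
true≢false ()

bool-ext : ∀ {a b} → (a ≡ true → b ≡ true) → (b ≡ true → a ≡ true) → a ≡ b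
bool-ext {true}          f g = sym (f refl)
bool-ext {false} {true}  f g = g refl
bool-ext {false} {false} f g = refl

not-false : ∀ {a} → a ≡ false → not a ≡ true
not-false refl = refl

not-true : ∀ {a} → not a ≡ true → a ≡ false
not-true {false} _ = refl

<ᵇ-true : ∀ {m n} → m ℕ.< n → (m <ᵇ n) ≡ true
<ᵇ-true m<n = Equivalence.to BoolP.T-≡ (ℕP.<⇒<ᵇ m<n)

<ᵇ-true⁻¹ : ∀ {m n} → (m <ᵇ n) ≡ true → m ℕ.< n
<ᵇ-true⁻¹ {m} {n} e = ℕP.<ᵇ⇒< m n (Equivalence.from BoolP.T-≡ e)

<ᵇ-false : ∀ {m n} → n ℕ.≤ m → (m <ᵇ n) ≡ false
<ᵇ-false {m} {n} n≤m with m <ᵇ n in eq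
... | false = refl
... | true  = ⊥-elim (ℕP.<⇒≱ (<ᵇ-true⁻¹ eq) n≤m)

≡ᵇ-true : ∀ {m n} → m ≡ n → (m ≡ᵇ n) ≡ true
≡ᵇ-true {m} {n} m≡n = Equivalence.to BoolP.T-≡ (ℕP.≡⇒≡ᵇ m n m≡n)

≡ᵇ-true⁻¹ : ∀ {m n} → (m ≡ᵇ n) ≡ true → m ≡ n
≡ᵇ-true⁻¹ {m} {n} e = ℕP.≡ᵇ⇒≡ m n (Equivalence.from BoolP.T-≡ e)

≡ᵇ-false : ∀ {m n} → m ≢ n → (m ≡ᵇ n) ≡ false
≡ᵇ-false {m} {n} m≢n with m ≡ᵇ n in eq
... | false = refl
... | true  = ⊥-elim (m≢n (≡ᵇ-true⁻¹ eq))

-- The order embedding of ℕ skipping K: the position in the (n+1)-gon of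
-- vertex x of the n-gon obtained by removing vertex K.
ins : ℕ → ℕ → ℕ
ins K x = if x <ᵇ K then x else suc x

ins-lt : ∀ {K x} → x ℕ.< K → ins K x ≡ x
ins-lt x<K rewrite <ᵇ-true x<K = refl

ins-ge : ∀ {K x} → K ℕ.≤ x → ins K x ≡ suc x
ins-ge {K} {x} K≤x rewrite <ᵇ-false {x} {K} K≤x = refl

ins-case : ∀ K x → (x ℕ.< K × ins K x ≡ x) ⊎ (K ℕ.≤ x × ins K x ≡ suc x)
ins-case K x with ℕP.<-≤-connex x K
... | inj₁ x<K = inj₁ (x<K , ins-lt x<K)
... | inj₂ K≤x = inj₂ (K≤x , ins-ge K≤x)

toℕ-punchIn : ∀ {n} (k : Fin (suc n)) (x : Fin n) → toℕ (punchIn k x) ≡ ins (toℕ k) (toℕ x)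
toℕ-punchIn Fin.zero    x          = refl
toℕ-punchIn (Fin.suc k) Fin.zero   = refl
toℕ-punchIn (Fin.suc k) (Fin.suc x) = trans (cong suc (toℕ-punchIn k x)) (suc-if (toℕ x <ᵇ toℕ k))
  where
  suc-if : ∀ b → suc (if b then toℕ x else suc (toℕ x)) ≡ (if b then suc (toℕ x) else suc (suc (toℕ x)))
  suc-if true  = refl
  suc-if false = refl

ins-≢K : ∀ K x → ins K x ≢ K
ins-≢K K x e with ins-case K x
... | inj₁ (x<K , e') = ℕP.<-irrefl (trans (sym e') e) x<K
... | inj₂ (K≤x , e') = ℕP.<-irrefl (sym (trans (sym e') e)) (ℕ.s≤s K≤x)

ins-mono : ∀ K {x y} → x ℕ.< y → ins K x ℕ.< ins K y
ins-mono K {x} {y} x<y with ins-case K x | ins-case K y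
... | inj₁ (_ , e₁) | inj₁ (_ , e₂) rewrite e₁ | e₂ = x<y
... | inj₁ (_ , e₁) | inj₂ (_ , e₂) rewrite e₁ | e₂ = ℕP.m≤n⇒m≤1+n x<y
... | inj₂ (K≤x , _) | inj₁ (y<K , _) = ⊥-elim (ℕP.<-asym x<y (ℕP.<-≤-trans y<K K≤x))
... | inj₂ (_ , e₁) | inj₂ (_ , e₂) rewrite e₁ | e₂ = ℕ.s≤s x<y

ins-reflects-< : ∀ K {x y} → ins K x ℕ.< ins K y → x ℕ.< y
ins-reflects-< K {x} {y} lt with ℕP.<-cmp x y
... | tri< x<y _ _  = x<y
... | tri≈ _ refl _ = ⊥-elim (ℕP.<-irrefl refl lt)
... | tri> _ _ y<x  = ⊥-elim (ℕP.<-asym lt (ins-mono K y<x))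

ins-injective : ∀ K {x y} → ins K x ≡ ins K y → x ≡ y
ins-injective K {x} {y} e with ℕP.<-cmp x y
... | tri< x<y _ _ = ⊥-elim (ℕP.<-irrefl e (ins-mono K x<y))
... | tri≈ _ x≡y _ = x≡y
... | tri> _ _ y<x = ⊥-elim (ℕP.<-irrefl (sym e) (ins-mono K y<x))

<ᵇ-ins : ∀ K x y → (ins K x <ᵇ ins K y) ≡ (x <ᵇ y)
<ᵇ-ins K x y = bool-ext (λ e → <ᵇ-true (ins-reflects-< K (<ᵇ-true⁻¹ e)))
                        (λ e → <ᵇ-true (ins-mono K (<ᵇ-true⁻¹ e)))

≡ᵇ-ins : ∀ K x y → (ins K x ≡ᵇ ins K y) ≡ (x ≡ᵇ y)
≡ᵇ-ins K x y = bool-ext (λ e → ≡ᵇ-true (ins-injective K (≡ᵇ-true⁻¹ e)))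
                        (λ e → ≡ᵇ-true (cong (ins K) (≡ᵇ-true⁻¹ e)))

ΣT : ∀ {n} → (Fin n → ℕ) → ℕ
ΣT g = sum (tabulate g)

sum-allFin : ∀ {n} (g : Fin n → ℕ) → sum (map g (allFin n)) ≡ ΣT g
sum-allFin g = cong sum (ListP.map-tabulate id g)

ΣT-cong : ∀ {n} {g h : Fin n → ℕ} → (∀ x → g x ≡ h x) → ΣT g ≡ ΣT h
ΣT-cong {zero}  e = refl
ΣT-cong {suc n} e = cong₂ ℕ._+_ (e Fin.zero) (ΣT-cong (e ∘ Fin.suc))

ΣT-zero : ∀ {n} {g : Fin n → ℕ} → (∀ x → g x ≡ 0) → ΣT g ≡ 0
ΣT-zero {zero}  e = refl
ΣT-zero {suc n} e = cong₂ ℕ._+_ (e Fin.zero) (ΣT-zero (e ∘ Fin.suc))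

ΣT-+ : ∀ {n} (g h : Fin n → ℕ) → ΣT (λ x → g x ℕ.+ h x) ≡ ΣT g ℕ.+ ΣT h
ΣT-+ {zero}  g h = refl
ΣT-+ {suc n} g h rewrite ΣT-+ (g ∘ Fin.suc) (h ∘ Fin.suc) =
  interchange (g Fin.zero) (h Fin.zero) (ΣT (g ∘ Fin.suc)) (ΣT (h ∘ Fin.suc))

ΣT-split : ∀ {n} (k : Fin (suc n)) (g : Fin (suc n) → ℕ) → ΣT g ≡ g k ℕ.+ ΣT (g ∘ punchIn k)
ΣT-split Fin.zero g = refl
ΣT-split {suc n} (Fin.suc k) g rewrite ΣT-split k (g ∘ Fin.suc) =
  x∙yz≈y∙xz (g Fin.zero) (g (Fin.suc k)) (ΣT (g ∘ Fin.suc ∘ punchIn k))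

ΣT-single : ∀ {n} (x₀ : Fin n) (g : Fin n → ℕ) → (∀ x → x ≢ x₀ → g x ≡ 0) → ΣT g ≡ g x₀
ΣT-single {suc n} x₀ g h = begin
  ΣT g                       ≡⟨ ΣT-split x₀ g ⟩
  g x₀ ℕ.+ ΣT (g ∘ punchIn x₀) ≡⟨ cong (g x₀ ℕ.+_) (ΣT-zero (λ x → h (punchIn x₀ x) (FinP.punchInᵢ≢i x₀ x))) ⟩
  g x₀ ℕ.+ 0                 ≡⟨ ℕP.+-identityʳ (g x₀) ⟩
  g x₀                       ∎
  where open ≡-Reasoning

Side : ℕ → ℕ → ℕ → Set
Side N a b = a ℕ.< b × (suc a ≡ b ⊎ (a ≡ 0 × suc b ≡ N))

-- isSide N a b unfolds to sideᵇ N (toℕ a) (toℕ b).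
sideᵇ : ℕ → ℕ → ℕ → Bool
sideᵇ N a b = (a <ᵇ b) ∧ ((suc a ≡ᵇ b) ∨ ((a ≡ᵇ 0) ∧ (suc b ≡ᵇ N)))

sideᵇ-true⁻¹ : ∀ N a b → sideᵇ N a b ≡ true → Side N a b
sideᵇ-true⁻¹ N a b e with ∧-split {a <ᵇ b} e
... | a<b , adjacent with ∨-split {suc a ≡ᵇ b} adjacent
... | inj₁ a+1≡b = <ᵇ-true⁻¹ a<b , inj₁ (≡ᵇ-true⁻¹ a+1≡b)
... | inj₂ ends   = <ᵇ-true⁻¹ a<b , inj₂ (≡ᵇ-true⁻¹ (proj₁ (∧-split ends)) , ≡ᵇ-true⁻¹ (proj₂ (∧-split {a ≡ᵇ 0} ends)))

sideᵇ-true : ∀ N a b → Side N a b → sideᵇ N a b ≡ true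
sideᵇ-true N a b (a<b , inj₁ e)         = ∧-pair (<ᵇ-true a<b) (∨-inl _ (≡ᵇ-true e))
sideᵇ-true N a b (a<b , inj₂ (e₁ , e₂)) = ∧-pair (<ᵇ-true a<b) (∨-inr (suc a ≡ᵇ b) (∧-pair (≡ᵇ-true e₁) (≡ᵇ-true e₂)))

<ᵇ-chain : ∀ {a b c d e f} → (a <ᵇ b) ∧ (c <ᵇ d) ∧ (e <ᵇ f) ≡ true → a ℕ.< b × c ℕ.< d × e ℕ.< f
<ᵇ-chain {a} {b} {c} {d} e with ∧-split {a <ᵇ b} e
... | ab , rest with ∧-split {c <ᵇ d} rest
... | cd , ef = <ᵇ-true⁻¹ ab , <ᵇ-true⁻¹ cd , <ᵇ-true⁻¹ ef

module TriangulationFacts {N : ℕ} (T : Triangulation N) where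

  D-lt : ∀ a b → D T a b ≡ true → toℕ a ℕ.< toℕ b
  D-lt a b e = <ᵇ-true⁻¹ (proj₁ (∧-split {toℕ a <ᵇ toℕ b} (D-diag T a b e)))

  D-not-side : ∀ a b → D T a b ≡ true → isSide N a b ≡ false
  D-not-side a b e = not-true (proj₂ (∧-split {toℕ a <ᵇ toℕ b} (D-diag T a b e)))

  edge-lt : ∀ a b → isEdge T a b ≡ true → toℕ a ℕ.< toℕ b
  edge-lt a b e with ∨-split {isSide N a b} {D T a b} e
  ... | inj₁ side = proj₁ (sideᵇ-true⁻¹ N (toℕ a) (toℕ b) side)
  ... | inj₂ diag = D-lt a b diag

  triangle-edges : ∀ a b c → isTriangle T a b c ≡ true →
                   isEdge T a b ≡ true × isEdge T b c ≡ true × isEdge T a c ≡ true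
  triangle-edges a b c e with ∧-split {isEdge T a b} {isEdge T b c ∧ isEdge T a c} e
  ... | ab , rest = ab , ∧-split {isEdge T b c} {isEdge T a c} rest

  triangle-lt : ∀ a b c → isTriangle T a b c ≡ true → toℕ a ℕ.< toℕ b × toℕ b ℕ.< toℕ c
  triangle-lt a b c e with triangle-edges a b c e
  ... | ab , bc , _ = edge-lt a b ab , edge-lt b c bc

  crosses-intro : ∀ (a b c d : Fin N) → toℕ a ℕ.< toℕ c → toℕ c ℕ.< toℕ b → toℕ b ℕ.< toℕ d →
                  crosses a b c d ≡ true
  crosses-intro a b c d a<c c<b b<d = ∨-inl _ (∧-pair (<ᵇ-true a<c) (∧-pair (<ᵇ-true c<b) (<ᵇ-true b<d)))

  crosses-elim : ∀ (a b c d : Fin N) → crosses a b c d ≡ true →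
    (toℕ a ℕ.< toℕ c × toℕ c ℕ.< toℕ b × toℕ b ℕ.< toℕ d) ⊎ (toℕ c ℕ.< toℕ a × toℕ a ℕ.< toℕ d × toℕ d ℕ.< toℕ b)
  crosses-elim a b c d e with ∨-split {(toℕ a <ᵇ toℕ c) ∧ (toℕ c <ᵇ toℕ b) ∧ (toℕ b <ᵇ toℕ d)} e
  ... | inj₁ acbd = inj₁ (<ᵇ-chain acbd)
  ... | inj₂ cadb = inj₂ (<ᵇ-chain cadb)

  no-crossing : ∀ a b c d → D T a b ≡ true → D T c d ≡ true → crosses a b c d ≡ true → ⊥
  no-crossing a b c d ab cd cr = true≢false (trans (sym cr) (noncross T a b c d ab cd))

-- Sides under the embedding ins K of the n-gon into the (n+1)-gon
-- (1 ≤ K < n): a side of the big polygon between vertices other than K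
-- comes from a side of the small one, and a side of the small polygon stays
-- a side unless it is the one, {K - 1, K}, that gets split by vertex K.
side-unins : ∀ {n K a b} → 1 ℕ.≤ K → K ℕ.< n → a ℕ.< n → b ℕ.< n →
             Side (suc n) (ins K a) (ins K b) → Side n a b
side-unins {n} {K} {a} {b} 1≤K K<n a<n b<n (lt , adj) = ins-reflects-< K lt , adjacent adj
  where
  adjacent : suc (ins K a) ≡ ins K b ⊎ (ins K a ≡ 0 × suc (ins K b) ≡ suc n) → suc a ≡ b ⊎ (a ≡ 0 × suc b ≡ n)
  adjacent (inj₁ e) with ins-case K a | ins-case K b
  ... | inj₁ (_ , e₁) | inj₁ (_ , e₂) = inj₁ (trans (cong suc (sym e₁)) (trans e e₂))
  ... | inj₂ (_ , e₁) | inj₂ (_ , e₂) = inj₁ (ℕP.suc-injective (trans (cong suc (sym e₁)) (trans e e₂)))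
  ... | inj₁ (_ , e₁) | inj₂ (_ , e₂) =
    ⊥-elim (ℕP.<-irrefl (ℕP.suc-injective (trans (cong suc (sym e₁)) (trans e e₂))) (ins-reflects-< K lt))
  ... | inj₂ (K≤a , _) | inj₁ (b<K , _) = ⊥-elim (ℕP.<-asym (ins-reflects-< K lt) (ℕP.<-≤-trans b<K K≤a))
  adjacent (inj₂ (e , e')) with ins-case K a | ins-case K b
  ... | inj₂ (_ , e₁) | _ = ⊥-elim (ℕP.0≢1+n (trans (sym e) e₁))
  ... | inj₁ (_ , e₁) | inj₁ (_ , e₂) =
    ⊥-elim (ℕP.<-irrefl (sym (ℕP.suc-injective (trans (sym e') (cong suc e₂)))) b<n)
  ... | inj₁ (_ , e₁) | inj₂ (_ , e₂) = inj₂ (trans (sym e₁) e , ℕP.suc-injective (trans (cong suc (sym e₂)) e'))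

side-ins : ∀ {n K a b} → 1 ℕ.≤ K → K ℕ.< n → Side n a b →
           (suc a ≡ K × b ≡ K) ⊎ Side (suc n) (ins K a) (ins K b)
side-ins {n} {K} {a} {b} 1≤K K<n (a<b , inj₁ e) with ins-case K a | ins-case K b
... | inj₁ (_ , e₁) | inj₁ (_ , e₂) = inj₂ (ins-mono K a<b , inj₁ (trans (cong suc e₁) (trans e (sym e₂))))
... | inj₂ (_ , e₁) | inj₂ (_ , e₂) = inj₂ (ins-mono K a<b , inj₁ (trans (cong suc e₁) (trans (cong suc e) (sym e₂))))
... | inj₁ (a<K , _) | inj₂ (K≤b , _) =
  inj₁ (ℕP.≤-antisym a<K (subst (K ℕ.≤_) (sym e) K≤b) , ℕP.≤-antisym (subst (ℕ._≤ K) e a<K) K≤b)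
... | inj₂ (K≤a , _) | inj₁ (b<K , _) = ⊥-elim (ℕP.<-asym a<b (ℕP.<-≤-trans b<K K≤a))
side-ins {n} {K} {a} {b} 1≤K K<n (a<b , inj₂ (a≡0 , b+1≡n)) = inj₂ (ins-mono K a<b , inj₂ (first , last))
  where
  first : ins K a ≡ 0
  first = trans (ins-lt (subst (ℕ._< K) (sym a≡0) 1≤K)) a≡0
  last : suc (ins K b) ≡ suc n
  last = cong suc (trans (ins-ge (ℕP.≤-pred (subst (K ℕ.<_) (sym b+1≡n) K<n))) b+1≡n)

-- An ear of a triangulation of the (n+1)-gon: a vertex k = p + 1 with
-- 1 ≤ k ≤ n - 1 at which no diagonal ends, so that k - 1, k, k + 1 span a
-- triangle.
record Ear {n : ℕ} (T : Triangulation (suc n)) : Set where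
  field
    k            : Fin (suc n)
    p            : ℕ
    position     : toℕ k ≡ suc p
    room         : suc p ℕ.< n
    no-diag-from : ∀ b → D T k b ≡ false
    no-diag-to   : ∀ a → D T a k ≡ false

no-diagonal-in-triangle : ∀ (x y : Fin 3) → isDiagonal 3 x y ≡ false
no-diagonal-in-triangle Fin.zero                   Fin.zero                   = refl
no-diagonal-in-triangle Fin.zero                   (Fin.suc Fin.zero)         = refl
no-diagonal-in-triangle Fin.zero                   (Fin.suc (Fin.suc Fin.zero)) = refl
no-diagonal-in-triangle (Fin.suc Fin.zero)         Fin.zero                   = refl
no-diagonal-in-triangle (Fin.suc Fin.zero)         (Fin.suc Fin.zero)         = refl
no-diagonal-in-triangle (Fin.suc Fin.zero)         (Fin.suc (Fin.suc Fin.zero)) = refl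
no-diagonal-in-triangle (Fin.suc (Fin.suc Fin.zero)) Fin.zero                 = refl
no-diagonal-in-triangle (Fin.suc (Fin.suc Fin.zero)) (Fin.suc Fin.zero)       = refl
no-diagonal-in-triangle (Fin.suc (Fin.suc Fin.zero)) (Fin.suc (Fin.suc Fin.zero)) = refl

len : ∀ {N} → Fin N → Fin N → ℕ
len a b = toℕ b ℕ.∸ toℕ a

module ShortestDiagonal {N : ℕ} (T : Triangulation N) where

  Minimal : Fin N → Fin N → Set
  Minimal a b = ∀ c d → D T c d ≡ true → len a b ℕ.≤ len c d

  ShortFrom : ℕ → Fin N → Set
  ShortFrom L c = ∃ λ d → D T c d ≡ true × len c d ℕ.≤ L

  short-from? : ∀ L c → Dec (ShortFrom L c)
  short-from? L c = FinP.any? (λ d → (D T c d BoolP.≟ true) ×-dec (len c d ℕ.≤? L))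

  shortest : ∀ L a b → D T a b ≡ true → len a b ℕ.≤ L →
             Σ (Fin N) λ a' → Σ (Fin N) λ b' → D T a' b' ≡ true × Minimal a' b'
  shortest zero a b ab l = a , b , ab , λ c d _ → ℕP.≤-trans l ℕ.z≤n
  shortest (suc L) a b ab l with FinP.any? (short-from? L)
  ... | yes (c , d , cd , l') = shortest L c d cd l'
  ... | no none = a , b , ab , λ c d cd → ℕP.≤-trans l (ℕP.≰⇒> (λ l' → none (c , d , cd , l')))

-- Below a shortest diagonal {a, b} lies an ear at a + 1: a diagonal at
-- a + 1 would either cross {a, b} or be shorter than it.
ear-under : ∀ {n} (T : Triangulation (suc n)) a b → D T a b ≡ true → ShortestDiagonal.Minimal T a b → Ear T
ear-under {n} T a b ab minimal = record
  { k = k ; p = toℕ a ; position = position ; room = room ; no-diag-from = from-k ; no-diag-to = to-k }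
  where
  open TriangulationFacts T
  a<b : toℕ a ℕ.< toℕ b
  a<b = D-lt a b ab
  a+2≤b : suc (suc (toℕ a)) ℕ.≤ toℕ b
  a+2≤b with ℕP.m≤n⇒m<n∨m≡n a<b
  ... | inj₁ a+1<b = a+1<b
  ... | inj₂ a+1≡b = ⊥-elim (true≢false (trans (sym (sideᵇ-true (suc n) (toℕ a) (toℕ b) (a<b , inj₁ a+1≡b)))
                                              (D-not-side a b ab)))
  a+1<N : suc (toℕ a) ℕ.< suc n
  a+1<N = ℕP.<-trans a+2≤b (FinP.toℕ<n b)
  k : Fin (suc n)
  k = fromℕ< a+1<N
  position : toℕ k ≡ suc (toℕ a)
  position = FinP.toℕ-fromℕ< a+1<N
  room : suc (toℕ a) ℕ.< n
  room = ℕP.≤-trans a+2≤b (ℕP.≤-pred (FinP.toℕ<n b))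
  a<k : toℕ a ℕ.< toℕ k
  a<k = subst (toℕ a ℕ.<_) (sym position) (ℕP.n<1+n _)
  k<b : toℕ k ℕ.< toℕ b
  k<b = subst (ℕ._< toℕ b) (sym position) a+2≤b
  shorter : ∀ x → toℕ x ℕ.≤ toℕ b → len k x ℕ.< len a b
  shorter x x≤b = ℕP.≤-<-trans (ℕP.∸-monoˡ-≤ (toℕ k) x≤b) (ℕP.∸-monoʳ-< a<k (ℕP.<⇒≤ k<b))
  from-k : ∀ x → D T k x ≡ false
  from-k x with D T k x in kx
  ... | false = refl
  ... | true with ℕP.<-cmp (toℕ b) (toℕ x)
  ... | tri< b<x _ _ = ⊥-elim (no-crossing a b k x ab kx (crosses-intro a b k x a<k k<b b<x))
  ... | tri≈ _ b≡x _ = ⊥-elim (ℕP.<⇒≱ (shorter x (ℕP.≤-reflexive (sym b≡x))) (minimal k x kx))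
  ... | tri> _ _ x<b = ⊥-elim (ℕP.<⇒≱ (shorter x (ℕP.<⇒≤ x<b)) (minimal k x kx))
  to-k : ∀ x → D T x k ≡ false
  to-k x with D T x k in xk
  ... | false = refl
  ... | true with ℕP.<-cmp (toℕ x) (toℕ a)
  ... | tri< x<a _ _ = ⊥-elim (no-crossing x k a b xk ab (crosses-intro x k a b x<a a<k k<b))
  ... | tri≈ _ x≡a _ = ⊥-elim (true≢false (trans (sym (sideᵇ-true (suc n) (toℕ x) (toℕ k)
                          (D-lt x k xk , inj₁ (trans (cong suc x≡a) (sym position))))) (D-not-side x k xk)))
  ... | tri> _ _ a<x = ⊥-elim (ℕP.<-irrefl refl (ℕP.<-≤-trans (subst (toℕ x ℕ.<_) position (D-lt x k xk)) a<x))

ear-exists : ∀ n (T : Triangulation (suc (suc (suc n)))) → Ear T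
ear-exists zero T = record
  { k = Fin.suc Fin.zero ; p = 0 ; position = refl ; room = ℕP.≤-refl
  ; no-diag-from = λ b → not-D (Fin.suc Fin.zero) b ; no-diag-to = λ a → not-D a (Fin.suc Fin.zero) }
  where
  not-D : ∀ a b → D T a b ≡ false
  not-D a b with D T a b in ab
  ... | false = refl
  ... | true  = ⊥-elim (true≢false (trans (sym (D-diag T a b ab)) (no-diagonal-in-triangle a b)))
ear-exists (suc n) T with some-diagonal
  where
  -- In a polygon with at least 4 vertices, {0, 2} is a diagonal, so it is in
  -- T or crossed by one in T.
  some-diagonal : ∃₂ λ a b → D T a b ≡ true
  some-diagonal with maximal T Fin.zero (Fin.suc (Fin.suc Fin.zero)) refl
  ... | inj₁ d                = _ , _ , d
  ... | inj₂ (c , d , cd , _) = c , d , cd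
... | a , b , ab with ShortestDiagonal.shortest T (len a b) a b ab ℕP.≤-refl
... | a' , b' , a'b' , minimal = ear-under T a' b' a'b' minimal

indicator : ∀ {N} → Triangulation N → Fin N → Fin N → Fin N → Fin N → ℕ
indicator T w a b c = if isTriangle T a b c ∧ incident w a b c then 1 else 0

trianglesAt-ΣT : ∀ {N} (T : Triangulation N) w →
                 trianglesAt T w ≡ ΣT (λ a → ΣT (λ b → ΣT (λ c → indicator T w a b c)))
trianglesAt-ΣT {N} T w =
  trans (sum-allFin (λ a → sum (map (λ b → sum (map (λ c → indicator T w a b c) (allFin N))) (allFin N))))
        (ΣT-cong (λ a → trans (sum-allFin (λ b → sum (map (λ c → indicator T w a b c) (allFin N))))
                              (ΣT-cong (λ b → sum-allFin (λ c → indicator T w a b c)))))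

indicator-non-triangle : ∀ {N} (T : Triangulation N) w a b c → ¬ isTriangle T a b c ≡ true → indicator T w a b c ≡ 0
indicator-non-triangle T w a b c not-triangle with isTriangle T a b c in triangle
... | true  = ⊥-elim (not-triangle refl)
... | false = refl

indicator-triangle : ∀ {N} (T : Triangulation N) w a b c → isTriangle T a b c ≡ true →
                     indicator T w a b c ≡ (if incident w a b c then 1 else 0)
indicator-triangle T w a b c triangle rewrite triangle = refl

no-triangles-in-2-gon : ∀ (T : Triangulation 2) v → trianglesAt T v ≡ 0
no-triangles-in-2-gon T v = trans (trianglesAt-ΣT T v) (ΣT-zero λ a → ΣT-zero λ b → ΣT-zero λ c →
  indicator-non-triangle T v a b c (λ e → no-chain a b c (TriangulationFacts.triangle-lt T a b c e)))
  where
  no-chain : ∀ (a b c : Fin 2) → ¬ (toℕ a ℕ.< toℕ b × toℕ b ℕ.< toℕ c)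
  no-chain a b c (a<b , b<c) = ℕP.<-irrefl refl
    (ℕP.≤-trans (ℕP.≤-trans (ℕ.s≤s (ℕ.s≤s ℕ.z≤n)) (ℕP.≤-trans (ℕ.s≤s a<b) b<c)) (ℕP.≤-pred (FinP.toℕ<n c)))

-- Removing an ear: the triangulation T of the (n+1)-gon restricts to a
-- triangulation T' of the n-gon formed by the other vertices, embedded by
-- ↑ = punchIn k.
module EarRemoval {n : ℕ} (T : Triangulation (suc n)) (E : Ear T) where
  open Ear E
  open TriangulationFacts T

  K : ℕ
  K = suc p

  1≤K : 1 ℕ.≤ K
  1≤K = ℕ.s≤s ℕ.z≤n

  ↑ : Fin n → Fin (suc n)
  ↑ = punchIn k

  toℕ-↑ : ∀ x → toℕ (↑ x) ≡ ins K (toℕ x)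
  toℕ-↑ x = trans (toℕ-punchIn k x) (cong (λ z → ins z (toℕ x)) position)

  is-k : ∀ x → toℕ x ≡ K → x ≡ k
  is-k x e = FinP.toℕ-injective (trans e (sym position))

  diagonal-avoids-k : ∀ a b → D T a b ≡ true → (a ≢ k) × (b ≢ k)
  diagonal-avoids-k a b e = (λ { refl → true≢false (trans (sym e) (no-diag-from b)) })
                          , (λ { refl → true≢false (trans (sym e) (no-diag-to a)) })

  between : ∀ {a z y} → suc a ≡ K → y ≡ suc K → a ℕ.< z → z ℕ.< y → z ≡ K
  between refl refl a<z z<y = ℕP.≤-antisym (ℕP.≤-pred z<y) a<z

  -- {K - 1, K + 1} is an edge: any diagonal crossing it would end at k.
  edge-across : ∀ x y → suc (toℕ x) ≡ K → toℕ y ≡ suc K → isEdge T x y ≡ true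
  edge-across x y ex ey with isSide (suc n) x y in side
  ... | true = refl
  ... | false with maximal T x y (∧-pair (<ᵇ-true x<y) (not-false side))
    where
    x<y : toℕ x ℕ.< toℕ y
    x<y = subst (toℕ x ℕ.<_) (sym ey) (subst (λ z → toℕ x ℕ.< suc z) ex (ℕP.m<n⇒m<1+n (ℕP.n<1+n (toℕ x))))
  ... | inj₁ d = d
  ... | inj₂ (c , d , cd , cr) with crosses-elim x y c d cr
  ... | inj₁ (x<c , c<y , _) = ⊥-elim (proj₁ (diagonal-avoids-k c d cd) (is-k c (between ex ey x<c c<y)))
  ... | inj₂ (_ , x<d , d<y) = ⊥-elim (proj₂ (diagonal-avoids-k c d cd) (is-k d (between ex ey x<d d<y)))

  edge-from-k : ∀ y → isEdge T k y ≡ true → toℕ y ≡ suc K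
  edge-from-k y e with ∨-split {isSide (suc n) k y} {D T k y} e
  ... | inj₂ d = ⊥-elim (true≢false (trans (sym d) (no-diag-from y)))
  ... | inj₁ s with sideᵇ-true⁻¹ (suc n) (toℕ k) (toℕ y) s
  ... | _ , inj₁ e'       = trans (sym e') (cong suc position)
  ... | _ , inj₂ (e₀ , _) = ⊥-elim (ℕP.0≢1+n (trans (sym e₀) position))

  edge-to-k : ∀ x → isEdge T x k ≡ true → suc (toℕ x) ≡ K
  edge-to-k x e with ∨-split {isSide (suc n) x k} {D T x k} e
  ... | inj₂ d = ⊥-elim (true≢false (trans (sym d) (no-diag-to x)))
  ... | inj₁ s with sideᵇ-true⁻¹ (suc n) (toℕ x) (toℕ k) s
  ... | _ , inj₁ e'       = trans e' position
  ... | _ , inj₂ (_ , e₁) = ⊥-elim (ℕP.<-irrefl (trans (sym position) (ℕP.suc-injective e₁)) room)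

  triangle-at-k : ∀ a b c → isTriangle T a b c ≡ true →
                  (a ≢ k) × (c ≢ k) × (b ≡ k → suc (toℕ a) ≡ K × toℕ c ≡ suc K)
  triangle-at-k a b c e = a≢k , c≢k , b≡k
    where
    ab : isEdge T a b ≡ true
    ab = proj₁ (triangle-edges a b c e)
    bc : isEdge T b c ≡ true
    bc = proj₁ (proj₂ (triangle-edges a b c e))
    ac : isEdge T a c ≡ true
    ac = proj₂ (proj₂ (triangle-edges a b c e))
    a≢k : a ≢ k
    a≢k refl = ℕP.<-irrefl (trans (edge-from-k b ab) (sym (edge-from-k c ac))) (edge-lt b c bc)
    c≢k : c ≢ k
    c≢k refl = ℕP.<-irrefl (ℕP.suc-injective (trans (edge-to-k a ac) (sym (edge-to-k b bc)))) (edge-lt a b ab)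
    b≡k : b ≡ k → suc (toℕ a) ≡ K × toℕ c ≡ suc K
    b≡k refl = edge-to-k a ab , edge-from-k c bc

  ↑-below : ∀ x → toℕ x ℕ.< K → toℕ (↑ x) ≡ toℕ x
  ↑-below x x<K = trans (toℕ-↑ x) (ins-lt x<K)

  ↑-above : ∀ x → K ℕ.≤ toℕ x → toℕ (↑ x) ≡ suc (toℕ x)
  ↑-above x K≤x = trans (toℕ-↑ x) (ins-ge K≤x)

  <ᵇ-↑ : ∀ a b → (toℕ (↑ a) <ᵇ toℕ (↑ b)) ≡ (toℕ a <ᵇ toℕ b)
  <ᵇ-↑ a b rewrite toℕ-↑ a | toℕ-↑ b = <ᵇ-ins K (toℕ a) (toℕ b)

  ≡ᵇ-↑ : ∀ a b → (toℕ (↑ a) ≡ᵇ toℕ (↑ b)) ≡ (toℕ a ≡ᵇ toℕ b)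
  ≡ᵇ-↑ a b rewrite toℕ-↑ a | toℕ-↑ b = ≡ᵇ-ins K (toℕ a) (toℕ b)

  crosses-↑ : ∀ a b c d → crosses (↑ a) (↑ b) (↑ c) (↑ d) ≡ crosses a b c d
  crosses-↑ a b c d rewrite <ᵇ-↑ a c | <ᵇ-↑ c b | <ᵇ-↑ b d | <ᵇ-↑ c a | <ᵇ-↑ a d | <ᵇ-↑ d b = refl

  side-from-↑ : ∀ a b → isSide (suc n) (↑ a) (↑ b) ≡ true → isSide n a b ≡ true
  side-from-↑ a b e = sideᵇ-true n (toℕ a) (toℕ b) (side-unins 1≤K room (FinP.toℕ<n a) (FinP.toℕ<n b)
    (subst₂ (Side (suc n)) (toℕ-↑ a) (toℕ-↑ b) (sideᵇ-true⁻¹ (suc n) (toℕ (↑ a)) (toℕ (↑ b)) e)))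

  side-to-↑ : ∀ a b → isSide n a b ≡ true →
              (suc (toℕ (↑ a)) ≡ K × toℕ (↑ b) ≡ suc K) ⊎ isSide (suc n) (↑ a) (↑ b) ≡ true
  side-to-↑ a b e with side-ins 1≤K room (sideᵇ-true⁻¹ n (toℕ a) (toℕ b) e)
  ... | inj₁ (a+1≡K , b≡K) = inj₁ ( trans (cong suc (↑-below a (ℕP.≤-reflexive a+1≡K))) a+1≡K
                                  , trans (↑-above b (ℕP.≤-reflexive (sym b≡K))) (cong suc b≡K))
  ... | inj₂ s = inj₂ (sideᵇ-true (suc n) (toℕ (↑ a)) (toℕ (↑ b))
                        (subst₂ (Side (suc n)) (sym (toℕ-↑ a)) (sym (toℕ-↑ b)) s))

  -- No edge {↑ a, ↑ b} crosses {K - 1, K + 1}, since it would have to end at K.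
  not-crossing-ear-base : ∀ a b x y → suc (toℕ x) ≡ K → toℕ y ≡ suc K →
                          crosses (↑ a) (↑ b) x y ≡ true → ⊥
  not-crossing-ear-base a b x y ex ey cr with crosses-elim (↑ a) (↑ b) x y cr
  ... | inj₁ (_ , x<b , b<y) = ins-≢K K (toℕ b) (trans (sym (toℕ-↑ b)) (between ex ey x<b b<y))
  ... | inj₂ (x<a , a<y , _) = ins-≢K K (toℕ a) (trans (sym (toℕ-↑ a)) (between ex ey x<a a<y))

  unpunch : ∀ x → x ≢ k → Σ (Fin n) λ x' → ↑ x' ≡ x
  unpunch x x≢k = punchOut k≢x , FinP.punchIn-punchOut k≢x
    where
    k≢x : k ≢ x
    k≢x e = x≢k (sym e)

  D' : Fin n → Fin n → Bool
  D' a b = isDiagonal n a b ∧ D T (↑ a) (↑ b)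

  restricted-diagonal : ∀ a b c d → D T (↑ c) (↑ d) ≡ true → crosses (↑ a) (↑ b) (↑ c) (↑ d) ≡ true →
                        D' c d ≡ true
  restricted-diagonal a b c d cd cr =
    ∧-pair (∧-pair (trans (sym (<ᵇ-↑ c d)) (<ᵇ-true (D-lt (↑ c) (↑ d) cd))) (not-false not-side)) cd
    where
    not-side : isSide n c d ≡ false
    not-side with isSide n c d in side
    ... | false = refl
    ... | true with side-to-↑ c d side
    ... | inj₁ (ec , ed) = ⊥-elim (not-crossing-ear-base a b (↑ c) (↑ d) ec ed cr)
    ... | inj₂ big-side  = ⊥-elim (true≢false (trans (sym big-side) (D-not-side (↑ c) (↑ d) cd)))

  maximal' : ∀ a b → isDiagonal n a b ≡ true → D' a b ≡ true ⊎ ∃₂ λ c d → D' c d ≡ true × crosses a b c d ≡ true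
  maximal' a b diag with ∧-split {toℕ a <ᵇ toℕ b} {not (isSide n a b)} diag
  ... | a<b , not-side with maximal T (↑ a) (↑ b) (∧-pair (trans (<ᵇ-↑ a b) a<b) (not-false not-big-side))
    where
    not-big-side : isSide (suc n) (↑ a) (↑ b) ≡ false
    not-big-side with isSide (suc n) (↑ a) (↑ b) in side
    ... | false = refl
    ... | true  = ⊥-elim (true≢false (trans (sym (side-from-↑ a b side)) (not-true not-side)))
  ... | inj₁ ab = inj₁ (∧-pair diag ab)
  ... | inj₂ (c , d , cd , cr) with unpunch c (proj₁ (diagonal-avoids-k c d cd))
                                  | unpunch d (proj₂ (diagonal-avoids-k c d cd))
  ... | c' , refl | d' , refl = inj₂ (c' , d' , restricted-diagonal a b c' d' cd cr , trans (sym (crosses-↑ a b c' d')) cr)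

  T' : Triangulation n
  T' = record
    { D        = D'
    ; D-diag   = λ a b e → proj₁ (∧-split {isDiagonal n a b} e)
    ; noncross = λ a b c d ab cd → trans (sym (crosses-↑ a b c d))
        (noncross T (↑ a) (↑ b) (↑ c) (↑ d) (proj₂ (∧-split {isDiagonal n a b} ab)) (proj₂ (∧-split {isDiagonal n c d} cd)))
    ; maximal  = maximal'
    }

  edge-↑ : ∀ a b → isEdge T (↑ a) (↑ b) ≡ isEdge T' a b
  edge-↑ a b = bool-ext forward backward
    where
    forward : isEdge T (↑ a) (↑ b) ≡ true → isEdge T' a b ≡ true
    forward e with ∨-split {isSide (suc n) (↑ a) (↑ b)} {D T (↑ a) (↑ b)} e
    ... | inj₁ s = ∨-inl _ (side-from-↑ a b s)
    ... | inj₂ d with isSide n a b in side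
    ... | true  = refl
    ... | false = ∧-pair (∧-pair (trans (sym (<ᵇ-↑ a b)) (<ᵇ-true (D-lt (↑ a) (↑ b) d))) refl) d
    backward : isEdge T' a b ≡ true → isEdge T (↑ a) (↑ b) ≡ true
    backward e with ∨-split {isSide n a b} {D' a b} e
    ... | inj₂ d' = ∨-inr (isSide (suc n) (↑ a) (↑ b)) (proj₂ (∧-split {isDiagonal n a b} d'))
    ... | inj₁ s with side-to-↑ a b s
    ... | inj₁ (ea , eb) = edge-across (↑ a) (↑ b) ea eb
    ... | inj₂ s'        = ∨-inl _ s'

  triangle-↑ : ∀ a b c → isTriangle T (↑ a) (↑ b) (↑ c) ≡ isTriangle T' a b c
  triangle-↑ a b c = cong₂ _∧_ (edge-↑ a b) (cong₂ _∧_ (edge-↑ b c) (edge-↑ a c))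

  incident-↑ : ∀ v a b c → incident (↑ v) (↑ a) (↑ b) (↑ c) ≡ incident v a b c
  incident-↑ v a b c = cong₂ _∨_ (≡ᵇ-↑ v a) (cong₂ _∨_ (≡ᵇ-↑ v b) (≡ᵇ-↑ v c))

  ↑-injective : ∀ u v → toℕ (↑ u) ≡ toℕ (↑ v) → u ≡ v
  ↑-injective u v e = FinP.punchIn-injective k u v (FinP.toℕ-injective e)

  -- The ear triangle {K - 1, K, K + 1} = {↑ a₀, k, ↑ b₀}.
  p<n : p ℕ.< n
  p<n = ℕP.<-trans (ℕP.n<1+n p) room

  a₀ : Fin n
  a₀ = fromℕ< p<n

  toℕ-↑a₀ : toℕ (↑ a₀) ≡ p
  toℕ-↑a₀ = trans (↑-below a₀ (subst (ℕ._< K) (sym (FinP.toℕ-fromℕ< p<n)) (ℕP.n<1+n p))) (FinP.toℕ-fromℕ< p<n)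

  b₀ : Fin n
  b₀ = fromℕ< room

  c₀ : Fin (suc n)
  c₀ = ↑ b₀

  toℕ-c₀ : toℕ c₀ ≡ suc K
  toℕ-c₀ = trans (↑-above b₀ (ℕP.≤-reflexive (sym (FinP.toℕ-fromℕ< room)))) (cong suc (FinP.toℕ-fromℕ< room))

  ear-triangle : isTriangle T (↑ a₀) k c₀ ≡ true
  ear-triangle = ∧-pair left-side (∧-pair right-side (edge-across (↑ a₀) c₀ (cong suc toℕ-↑a₀) toℕ-c₀))
    where
    left-side : isEdge T (↑ a₀) k ≡ true
    left-side = ∨-inl _ (sideᵇ-true (suc n) (toℕ (↑ a₀)) (toℕ k)
      (subst (ℕ._< toℕ k) (sym toℕ-↑a₀) (ℕP.≤-reflexive (sym position)) , inj₁ (trans (cong suc toℕ-↑a₀) (sym position))))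
    right-side : isEdge T k c₀ ≡ true
    right-side = ∨-inl _ (sideᵇ-true (suc n) (toℕ k) (toℕ c₀)
      (subst₂ ℕ._<_ (sym position) (sym toℕ-c₀) (ℕP.n<1+n K) , inj₁ (trans (cong suc position) (sym toℕ-c₀))))

  -- Splitting the triple sum of trianglesAt at k in each coordinate: only
  -- the ear triangle involves k.
  module Decomposition (w : Fin (suc n)) where
    F : Fin (suc n) → Fin (suc n) → Fin (suc n) → ℕ
    F = indicator T w

    away-from-k : ℕ
    away-from-k = ΣT (λ a → ΣT (λ b → ΣT (λ c → F (↑ a) (↑ b) (↑ c))))

    first-k : ΣT (λ b → ΣT (λ c → F k b c)) ≡ 0
    first-k = ΣT-zero λ b → ΣT-zero λ c →
      indicator-non-triangle T w k b c (λ e → proj₁ (triangle-at-k k b c e) refl)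

    last-k : ∀ a b → F (↑ a) (↑ b) k ≡ 0
    last-k a b = indicator-non-triangle T w (↑ a) (↑ b) k (λ e → proj₁ (proj₂ (triangle-at-k (↑ a) (↑ b) k e)) refl)

    middle-split : ∀ a → ΣT (λ b → ΣT (λ c → F (↑ a) b c))
                       ≡ ΣT (λ c → F (↑ a) k c) ℕ.+ ΣT (λ b → ΣT (λ c → F (↑ a) (↑ b) (↑ c)))
    middle-split a = trans (ΣT-split k (λ b → ΣT (λ c → F (↑ a) b c)))
      (cong (ΣT (λ c → F (↑ a) k c) ℕ.+_) (ΣT-cong λ b →
        trans (ΣT-split k (F (↑ a) (↑ b))) (cong (ℕ._+ ΣT (λ c → F (↑ a) (↑ b) (↑ c))) (last-k a b))))

    ear-only : ∀ a c → isTriangle T (↑ a) k c ≡ true → a ≡ a₀ × c ≡ c₀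
    ear-only a c e = ↑-injective a a₀ (ℕP.suc-injective (trans left (cong suc (sym toℕ-↑a₀))))
                   , FinP.toℕ-injective (trans right (sym toℕ-c₀))
      where
      left : suc (toℕ (↑ a)) ≡ K
      left = proj₁ (proj₂ (proj₂ (triangle-at-k (↑ a) k c e)) refl)
      right : toℕ c ≡ suc K
      right = proj₂ (proj₂ (proj₂ (triangle-at-k (↑ a) k c e)) refl)

    middle-k : ΣT (λ a → ΣT (λ c → F (↑ a) k c)) ≡ F (↑ a₀) k c₀
    middle-k = trans (ΣT-single a₀ _ λ a a≢a₀ → ΣT-zero λ c →
                        indicator-non-triangle T w (↑ a) k c (λ e → a≢a₀ (proj₁ (ear-only a c e))))
                     (ΣT-single c₀ _ λ c c≢c₀ →
                        indicator-non-triangle T w (↑ a₀) k c (λ e → c≢c₀ (proj₂ (ear-only a₀ c e))))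

    decomposition : trianglesAt T w ≡ F (↑ a₀) k c₀ ℕ.+ away-from-k
    decomposition = begin
      trianglesAt T w
        ≡⟨ trianglesAt-ΣT T w ⟩
      ΣT (λ a → ΣT (λ b → ΣT (λ c → F a b c)))
        ≡⟨ ΣT-split k (λ a → ΣT (λ b → ΣT (λ c → F a b c))) ⟩
      ΣT (λ b → ΣT (λ c → F k b c)) ℕ.+ ΣT (λ a → ΣT (λ b → ΣT (λ c → F (↑ a) b c)))
        ≡⟨ cong₂ ℕ._+_ first-k (ΣT-cong middle-split) ⟩
      ΣT (λ a → ΣT (λ c → F (↑ a) k c) ℕ.+ ΣT (λ b → ΣT (λ c → F (↑ a) (↑ b) (↑ c))))
        ≡⟨ ΣT-+ (λ a → ΣT (λ c → F (↑ a) k c)) (λ a → ΣT (λ b → ΣT (λ c → F (↑ a) (↑ b) (↑ c)))) ⟩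
      ΣT (λ a → ΣT (λ c → F (↑ a) k c)) ℕ.+ away-from-k
        ≡⟨ cong (ℕ._+ away-from-k) middle-k ⟩
      F (↑ a₀) k c₀ ℕ.+ away-from-k ∎
      where open ≡-Reasoning

  open Decomposition using (decomposition)

  ear-incidence : Fin n → ℕ
  ear-incidence v = if incident (↑ v) (↑ a₀) k c₀ then 1 else 0

  count-↑ : ∀ v → trianglesAt T (↑ v) ≡ ear-incidence v ℕ.+ trianglesAt T' v
  count-↑ v = trans (decomposition (↑ v)) (cong₂ ℕ._+_ (indicator-triangle T (↑ v) (↑ a₀) k c₀ ear-triangle)
    (trans (ΣT-cong λ a → ΣT-cong λ b → ΣT-cong λ c →
              cong (λ z → if z then 1 else 0) (cong₂ _∧_ (triangle-↑ a b c) (incident-↑ v a b c)))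
           (sym (trianglesAt-ΣT T' v))))

  count-k : trianglesAt T k ≡ 1
  count-k = trans (decomposition k)
    (cong₂ ℕ._+_ (trans (indicator-triangle T k (↑ a₀) k c₀ ear-triangle) on-ear)
                 (ΣT-zero λ a → ΣT-zero λ b → ΣT-zero λ c → off-ear a b c))
    where
    on-ear : (if incident k (↑ a₀) k c₀ then 1 else 0) ≡ 1
    on-ear rewrite ∨-inr (toℕ k ≡ᵇ toℕ (↑ a₀)) (∨-inl (toℕ k ≡ᵇ toℕ c₀) (≡ᵇ-true {toℕ k} refl)) = refl
    k≢↑ : ∀ x → toℕ k ≢ toℕ (↑ x)
    k≢↑ x e = ins-≢K K (toℕ x) (trans (sym (toℕ-↑ x)) (trans (sym e) position))
    off-ear : ∀ a b c → indicator T k (↑ a) (↑ b) (↑ c) ≡ 0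
    off-ear a b c rewrite ∨-false (≡ᵇ-false (k≢↑ a)) (∨-false (≡ᵇ-false (k≢↑ b)) (≡ᵇ-false (k≢↑ c)))
                        | BoolP.∧-zeroʳ (isTriangle T (↑ a) (↑ b) (↑ c)) = refl

  neighbour-incidence : ∀ v → v ≡ a₀ ⊎ v ≡ b₀ → ear-incidence v ≡ 1
  neighbour-incidence v (inj₁ refl) rewrite ≡ᵇ-true {toℕ (↑ a₀)} refl = refl
  neighbour-incidence v (inj₂ refl)
    rewrite ∨-inr (toℕ c₀ ≡ᵇ toℕ (↑ a₀)) (∨-inr (toℕ c₀ ≡ᵇ toℕ k) (≡ᵇ-true {toℕ c₀} refl)) = refl

  far-incidence : ∀ v → v ≢ a₀ → v ≢ b₀ → ear-incidence v ≡ 0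
  far-incidence v v≢a₀ v≢b₀
    rewrite ∨-false {toℕ (↑ v) ≡ᵇ toℕ (↑ a₀)} (≡ᵇ-false (v≢a₀ ∘ ↑-injective v a₀))
                    (∨-false (≡ᵇ-false (λ e → ins-≢K K (toℕ v) (trans (sym (toℕ-↑ v)) (trans e position))))
                             (≡ᵇ-false (v≢b₀ ∘ ↑-injective v b₀))) = refl

  c c' : ℕ → ℤ
  c  j = ext (suc n) (trianglesAt T) (+ j)
  c' j = ext n (trianglesAt T') (+ j)

  coefficient : ∀ j (j<n : j ℕ.< n) → c (ins K j) ≡ c' j + + ear-incidence (fromℕ< j<n)
  coefficient j j<n = begin
    ext (suc n) (trianglesAt T) (+ ins K j)           ≡⟨ cong (λ i → ext (suc n) (trianglesAt T) (+ i)) (sym toℕ-↑v) ⟩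
    ext (suc n) (trianglesAt T) (+ toℕ (↑ v))         ≡⟨ ext-at (suc n) (trianglesAt T) (↑ v) ⟩
    + trianglesAt T (↑ v)                             ≡⟨ cong +_ (trans (count-↑ v) (ℕP.+-comm (ear-incidence v) (trianglesAt T' v))) ⟩
    + trianglesAt T' v + + ear-incidence v            ≡⟨ cong (_+ + ear-incidence v) (sym c'-at) ⟩
    c' j + + ear-incidence v                          ∎
    where
    open ≡-Reasoning
    v : Fin n
    v = fromℕ< j<n
    toℕ-v : toℕ v ≡ j
    toℕ-v = FinP.toℕ-fromℕ< j<n
    toℕ-↑v : toℕ (↑ v) ≡ ins K j
    toℕ-↑v = trans (toℕ-↑ v) (cong (ins K) toℕ-v)
    c'-at : c' j ≡ + trianglesAt T' v
    c'-at = trans (cong (λ i → ext n (trianglesAt T') (+ i)) (sym toℕ-v)) (ext-at n (trianglesAt T') v)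

  far-coefficient : ∀ j → j ≢ p → j ≢ K → (j<n : j ℕ.< n) → c (ins K j) ≡ c' j
  far-coefficient j j≢p j≢K j<n = trans (coefficient j j<n)
    (trans (cong (λ i → c' j + + i) (far-incidence v (λ e → j≢p (index e (FinP.toℕ-fromℕ< p<n)))
                                                     (λ e → j≢K (index e (FinP.toℕ-fromℕ< room)))))
           (ℤP.+-identityʳ (c' j)))
    where
    v : Fin n
    v = fromℕ< j<n
    index : ∀ {x i} → v ≡ x → toℕ x ≡ i → j ≡ i
    index refl e = trans (sym (FinP.toℕ-fromℕ< j<n)) e

  ear-insertion : EarInsertion n p c c'
  ear-insertion = record
    { room   = room
    ; before = λ j j<p → trans (cong c (sym (ins-lt (ℕP.<-trans j<p (ℕP.n<1+n p)))))
        (far-coefficient j (ℕP.<⇒≢ j<p) (ℕP.<⇒≢ (ℕP.<-trans j<p (ℕP.n<1+n p))) (ℕP.<-trans j<p p<n))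
    ; left   = trans (cong c (sym (ins-lt (ℕP.n<1+n p))))
        (trans (coefficient p p<n) (cong (λ i → c' p + + i) (neighbour-incidence a₀ (inj₁ refl))))
    ; ear    = trans (cong (λ i → ext (suc n) (trianglesAt T) (+ i)) (sym position))
        (trans (ext-at (suc n) (trianglesAt T) k) (cong +_ count-k))
    ; right  = trans (cong c (sym (ins-ge (ℕP.≤-refl {K}))))
        (trans (coefficient K room) (cong (λ i → c' K + + i) (neighbour-incidence b₀ (inj₂ refl))))
    ; after  = λ j K+1≤j j<n → trans (cong c (sym (ins-ge (ℕP.≤-trans (ℕP.n≤1+n K) K+1≤j))))
        (far-coefficient j (λ j≡p → ℕP.<-irrefl (sym j≡p) (ℕP.<-trans (ℕP.n<1+n p) (ℕP.<-≤-trans (ℕP.n<1+n K) K+1≤j)))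
                           (λ j≡K → ℕP.<-irrefl (sym j≡K) K+1≤j) j<n)
    }

-- The degenerate quiddity (0, 0): on -1, …, 2, s = (-1, 0, 1, 0) and t = (0, 1, 0, -1).
admissible-2-gon : Admissible 2 (λ _ → 0ℤ)
admissible-2-gon = record
  { s-last = refl ; s-end = refl ; t-last = refl ; t-end = refl ; nonneg = nonneg }
  where
  nonneg : ∀ j → j ℕ.< 2 → 0ℤ ℤ.≤ fundS (λ _ → 0ℤ) (suc j) × 0ℤ ℤ.≤ fundT (λ _ → 0ℤ) (suc j)
  nonneg zero       _ = ℤ.+≤+ ℕ.z≤n , ℤ.+≤+ ℕ.z≤n
  nonneg (suc zero) _ = ℤ.+≤+ ℕ.z≤n , ℤ.+≤+ ℕ.z≤n
  nonneg (suc (suc j)) (ℕ.s≤s (ℕ.s≤s ()))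

triangulation-admissible : ∀ n₂ (T : Triangulation (suc (suc n₂))) →
                           Admissible (suc (suc n₂)) (λ j → ext (suc (suc n₂)) (trianglesAt T) (+ j))
triangulation-admissible zero T =
  admissible-cong (λ j → ext-cong 2 (λ v → sym (no-triangles-in-2-gon T v)) (+ j)) admissible-2-gon
triangulation-admissible (suc n₃) T =
  insertion-admissible ear-insertion (triangulation-admissible n₃ T')
  where open EarRemoval T (ear-exists n₃ T)

quiddity-admissible : ∀ n₁ (q : Fin (suc n₁) → ℕ) → 1 ℕ.≤ n₁ → Quiddity (suc n₁) q →
                      Admissible (suc n₁) (λ j → ext (suc n₁) q (+ j))
quiddity-admissible .1 q _ (inj₁ (refl , all-zero)) =
  admissible-cong (λ j → ext-cong 2 (λ i → sym (all-zero i)) (+ j)) admissible-2-gon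
quiddity-admissible (suc n₂) q _ (inj₂ (_ , T , q≡)) =
  admissible-cong (λ j → ext-cong (suc (suc n₂)) (λ i → sym (q≡ i)) (+ j)) (triangulation-admissible n₂ T)

corollary4p3 : (n m : ℕ) → 2 ≤ n → 2 ≤ m →
    (q : Fin n → ℕ) (q' : Fin m → ℕ) → Quiddity n q → Quiddity m q' →
    Σ (ℕ → Array) λ A →
      (∀ k → IsSolution n m q q' (A k))
      × (∀ k l → ¬ k ≡ l → ∃₂ λ (i j : ℤ) → ¬ A k i j ≡ A l i j)
corollary4p3 (suc n₁) (suc m₁) (ℕ.s≤s 1≤n₁) (ℕ.s≤s 1≤m₁) q q' quiddity-q quiddity-q' =
  arrays-from-admissible n₁ m₁ q q'
    (quiddity-admissible n₁ q 1≤n₁ quiddity-q)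
    (quiddity-admissible m₁ q' 1≤m₁ quiddity-q')
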